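{- Let $a,b$ be relatively prime integers such that the Lucas sequences below are non-degenerate, and suppose $a>0$ and $\Delta=a^2+4b>0$. Then for each positive integer $n$ and each prime $p\geq 3$, $$\tau(U_nU_{n+p}U_{n+2p})=\begin{cases} n(n+p)(n+2p), & p\nmid n,\ 2\nmid n,\\[2pt] \dfrac{n(n+p)(n+2p)}{2}\cdot\dfrac{a}{\gcd(a,n+p)}, & p\nmid n,\ 2\mid n,\\[2pt] \dfrac{n(n+p)(n+2p)}{p^2}U_p^2, & p\mid n,\ 2\nmid n,\\[2pt] \dfrac{n(n+p)(n+2p)}{2p^2}\cdot\dfrac{U_p^2V_p}{\gcd(V_p,(n+p)/p)}, & p\mid n,\ 2\mid n.\end{cases}$$
   Context: For relatively prime integers $a,b$, the first and second Lucas sequences are defined by $U_0=0$, $U_1=1$, $U_{n+2}=aU_{n+1}+bU_n$ and $V_0=2$, $V_1=a$, $V_{n+2}=aV_{n+1}+bV_n$ ($n\ge 0$). Non-degenerate means $b\neq 0$ and $\alpha/\beta$ is not a root of unity, where $\alpha,\beta$ are the roots of $x^2-ax-b=0$. For a positive integer $k$ with $\gcd(k,b)=1$, $\tau(k)$ (the order of appearance) is the smallest positive integer $t$ with $k\mid U_t$. -}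

module Defs where

open import Data.Nat as ℕ using (ℕ; zero; suc)
open import Data.Integer using (ℤ; +_; _+_; _*_; -_; _-_; _>_)
open import Data.Integer.Divisibility using (_∣_)
open import Data.Product using (_×_; _,_; Σ; ∃-syntax)
open import Relation.Binary.PropositionalEquality using (_≡_; _≢_)
open import Relation.Nullary using (¬_)

U : ℤ → ℤ → ℕ → ℤ
U a b zero = + 0
U a b (suc zero) = + 1
U a b (suc (suc n)) = a * U a b (suc n) + b * U a b n

V : ℤ → ℤ → ℕ → ℤ
V a b zero = + 2
V a b (suc zero) = a
V a b (suc (suc n)) = a * V a b (suc n) + b * V a b n

-- The splitting algebra ℤ[x]/(x² - a x - b), elements c + d·x stored as (c , d).
-- α is the class of x and β = a - x is the other root (α + β = a, αβ = -b).
QA : Set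
QA = ℤ × ℤ

qmul : ℤ → ℤ → QA → QA → QA
qmul a b (c , d) (e , f) = (c * e + b * (d * f) , c * f + d * e + a * (d * f))

qpow : ℤ → ℤ → QA → ℕ → QA
qpow a b u zero = (+ 1 , + 0)
qpow a b u (suc k) = qmul a b u (qpow a b u k)

αroot : ℤ → ℤ → QA
αroot a b = (+ 0 , + 1)

βroot : ℤ → ℤ → QA
βroot a b = (a , - (+ 1))

-- α/β is a root of unity: (α/β)^k = 1 for some k ≥ 1, i.e. α^k = β^k (β invertible as b ≠ 0)
RatioRootOfUnity : ℤ → ℤ → Set
RatioRootOfUnity a b =
  ∃[ k ] (0 ℕ.< k × qpow a b (αroot a b) k ≡ qpow a b (βroot a b) k)

NonDegenerate : ℤ → ℤ → Set
NonDegenerate a b = (b ≢ + 0) × ¬ RatioRootOfUnity a b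

IsOrderOfAppearance : ℤ → ℤ → ℤ → ℕ → Set
IsOrderOfAppearance a b k t =
  (0 ℕ.< t) × (k ∣ U a b t) × (∀ s → 0 ℕ.< s → k ∣ U a b s → t ℕ.≤ s)

{-# OPTIONS --safe #-}
module Submission where

-- Since a > 0 and Δ > 0, U is non-negative and increasing from U 2 on, so U j ∣ U s forces
-- j ∣ s for j ≠ 2; moreover U is a strong divisibility sequence. Hence the order of
-- appearance of K = U n U (n+p) U (n+2p) is a multiple of lcm (n, n+p, n+2p), and equals it
-- when the three indices are pairwise coprime. Otherwise write the indices sharing a factor
-- d ∈ {2, p, 2p} as k d and put ω d k = U (k d) / U d. At a prime q dividing U d, lifting
-- the exponent gives ν_q (ω d k) = ν_q k (up to ν₂ (V d) when q = 2 and d is odd); at the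
-- other primes the factors ω d k are pairwise coprime. Comparing valuations prime by prime,
-- K ∣ U s exactly when s is a multiple of the lcm times the part of U d that the indices do
-- not already supply: a / gcd (a, n+p), (U p)² or (U p)² V p / gcd (V p, (n+p)/p).

import Data.Integer.Base as ℤ
import Data.Integer.Coprimality as ℤ
open import Relation.Binary.PropositionalEquality using (_≢_)

module Arithmetic where

  open import Data.Nat.Base
  open import Data.Nat.Properties
  open import Data.Nat.Divisibility
  open import Data.Nat.Primality using (Prime; prime⇒nonTrivial; prime⇒irreducible)
  open import Data.Sum.Base using (inj₁; inj₂)
  open import Relation.Nullary using (¬_)
  open import Relation.Nullary.Negation using (contradiction)
  open import Relation.Binary.PropositionalEquality

  prime≥2 : ∀ {q} → Prime q → 2 ≤ q
  prime≥2 {q} pq = nonTrivial⇒n>1 q {{prime⇒nonTrivial pq}}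

  prime∣prime⇒≡ : ∀ {q p} → Prime q → Prime p → q ∣ p → q ≡ p
  prime∣prime⇒≡ pq pp q∣p with prime⇒irreducible pp q∣p
  ... | inj₁ q≡1 = contradiction q≡1 (>⇒≢ (prime≥2 pq))
  ... | inj₂ q≡p = q≡p

  m∣m*n*o : ∀ x y z → x ∣ x * y * z
  m∣m*n*o x y z = ∣-trans (m∣m*n y) (m∣m*n z)

  +-nonZero : ∀ m n → .{{NonZero m}} → NonZero (m + n)
  +-nonZero (suc m) n = _

  ≥3⇒≢2 : ∀ {x} → 3 ≤ x → x ≢ 2
  ≥3⇒≢2 3≤x refl = <⇒≱ (s≤s (s≤s (s≤s z≤n))) 3≤x

  ¬2∣⇒2∣suc : ∀ m → ¬ 2 ∣ m → 2 ∣ suc m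
  ¬2∣⇒2∣suc zero 2∤0 = contradiction (2 ∣0) 2∤0
  ¬2∣⇒2∣suc (suc zero) _ = ∣-refl
  ¬2∣⇒2∣suc (suc (suc m)) 2∤m+2 =
    ∣m∣n⇒∣m+n (∣-refl {2}) (¬2∣⇒2∣suc m λ 2∣m → 2∤m+2 (∣m∣n⇒∣m+n (∣-refl {2}) 2∣m))

module Valuation where

  open import Data.Nat.Base
  open import Data.Nat.Properties
  open import Data.Nat.Divisibility
  open import Data.Nat.Primality using (Prime; euclidsLemma; productOfPrimes≢0)
  open import Data.Nat.Primality.Factorisation using (factorise; module PrimeFactorisation)
  open import Data.Nat.ListAction using (product)
  open import Data.List.Base using ([]; _∷_)
  open import Data.List.Relation.Unary.All using (All; []; _∷_)
  open import Data.Sum.Base using (inj₁; inj₂)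
  open import Function.Base using (it)
  open import Relation.Nullary using (¬_; yes; no)
  open import Relation.Nullary.Negation using (contradiction)
  open import Relation.Binary.PropositionalEquality
  open import Data.Nat.Tactic.RingSolver using (solve-∀)
  open Arithmetic using (prime≥2)

  record ExactPower (q e x : ℕ) : Set where
    constructor exact
    field
      cofactor : ℕ
      split : x ≡ q ^ e * cofactor
      ∤cofactor : ¬ q ∣ cofactor

  -- ν q x divides x by q as long as possible; the fuel x suffices when 2 ≤ q.
  -- The values for q < 2 or x = 0 are junk.
  νWithin : ℕ → ℕ → ℕ → ℕ
  νWithin zero q x = 0
  νWithin (suc fuel) q x with q ∣? x
  ... | yes (divides k _) = suc (νWithin fuel q k)
  ... | no _ = 0

  ν : ℕ → ℕ → ℕ
  ν q x = νWithin x q x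

  νWithin-exact : ∀ fuel {q} x → 2 ≤ q → .{{NonZero x}} → x ≤ fuel → ExactPower q (νWithin fuel q x) x
  νWithin-exact zero (suc x) q≥2 ()
  νWithin-exact (suc fuel) {q} x q≥2 x≤fuel with q ∣? x
  ... | no q∤x = exact x (sym (*-identityˡ x)) q∤x
  ... | yes (divides zero x≡0) = contradiction x≡0 (≢-nonZero⁻¹ x)
  ... | yes (divides k@(suc _) x≡kq) with νWithin-exact fuel k q≥2 k<fuel
    where
    k<fuel : k ≤ fuel
    k<fuel = ≤-pred (≤-trans (subst (k <_) (sym x≡kq) (m<m*n k q q≥2)) x≤fuel)
  ...   | exact r k≡qᵉr q∤r = exact r x≡qᵉ⁺¹r q∤r
    where
    x≡qᵉ⁺¹r : x ≡ q ^ suc (νWithin fuel q k) * r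
    x≡qᵉ⁺¹r = trans x≡kq (trans (cong (_* q) k≡qᵉr) (lemma (q ^ νWithin fuel q k) r q))
      where
      lemma : ∀ a b c → a * b * c ≡ c * a * b
      lemma = solve-∀

  ν-exact : ∀ {q} x → 2 ≤ q → .{{NonZero x}} → ExactPower q (ν q x) x
  ν-exact x q≥2 = νWithin-exact x x q≥2 ≤-refl

  exactPower-unique : ∀ {q e e′ x} → 2 ≤ q → ExactPower q e x → ExactPower q e′ x → e ≡ e′
  exactPower-unique {q} {zero} {zero} _ _ _ = refl
  exactPower-unique {q} {zero} {suc e′} _ (exact r x≡r q∤r) (exact r′ x≡qᵉr′ _) =
    contradiction (divides (q ^ e′ * r′) r≡) q∤r
    where
    r≡ : r ≡ q ^ e′ * r′ * q
    r≡ = trans (trans (sym (*-identityˡ r)) (trans (sym x≡r) x≡qᵉr′)) (lemma q (q ^ e′) r′)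
      where
      lemma : ∀ a b c → a * b * c ≡ b * c * a
      lemma = solve-∀
  exactPower-unique {q} {suc e} {zero} q≥2 E E′ = sym (exactPower-unique q≥2 E′ E)
  exactPower-unique {q} {suc e} {suc e′} {x} q≥2 (exact r x≡ q∤r) (exact r′ x≡′ q∤r′) =
    cong suc (exactPower-unique q≥2 (exact r refl q∤r) (exact r′ (*-cancelˡ-≡ _ _ q {{q≢0}} qx≡) q∤r′))
    where
    q≢0 : NonZero q
    q≢0 = >-nonZero (≤-trans (s≤s z≤n) q≥2)
    qx≡ : q * (q ^ e * r) ≡ q * (q ^ e′ * r′)
    qx≡ = trans (sym (*-assoc q (q ^ e) r)) (trans (trans (sym x≡) x≡′) (*-assoc q (q ^ e′) r′))

  ν-unique : ∀ {q e x} → 2 ≤ q → .{{NonZero x}} → ExactPower q e x → ν q x ≡ e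
  ν-unique {x = x} q≥2 E = exactPower-unique q≥2 (ν-exact x q≥2) E

  ν-∤ : ∀ {q x} → 2 ≤ q → .{{NonZero x}} → ¬ q ∣ x → ν q x ≡ 0
  ν-∤ {x = x} q≥2 q∤x = ν-unique q≥2 (exact x (sym (*-identityˡ x)) q∤x)

  ν-* : ∀ {q} → Prime q → ∀ x y → .{{NonZero x}} → .{{NonZero y}} → ν q (x * y) ≡ ν q x + ν q y
  ν-* {q} pq x y with ν-exact {q} x (prime≥2 pq) | ν-exact {q} y (prime≥2 pq)
  ... | exact r x≡ q∤r | exact s y≡ q∤s = ν-unique (prime≥2 pq) {{m*n≢0 x y}} (exact (r * s) xy≡ q∤rs)
    where
    xy≡ : x * y ≡ q ^ (ν q x + ν q y) * (r * s)
    xy≡ = begin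
      x * y                               ≡⟨ cong₂ _*_ x≡ y≡ ⟩
      q ^ ν q x * r * (q ^ ν q y * s)     ≡⟨ lemma (q ^ ν q x) r (q ^ ν q y) s ⟩
      q ^ ν q x * q ^ ν q y * (r * s)     ≡⟨ cong (_* (r * s)) (^-distribˡ-+-* q (ν q x) (ν q y)) ⟨
      q ^ (ν q x + ν q y) * (r * s)       ∎
      where
      open ≡-Reasoning
      lemma : ∀ a b c d → a * b * (c * d) ≡ a * c * (b * d)
      lemma = solve-∀
    q∤rs : ¬ q ∣ r * s
    q∤rs q∣rs with euclidsLemma r s pq q∣rs
    ... | inj₁ q∣r = q∤r q∣r
    ... | inj₂ q∣s = q∤s q∣s

  ν-self : ∀ {q} → Prime q → ν q q ≡ 1
  ν-self {q} pq = ν-unique (prime≥2 pq) {{q≢0}} (exact 1 (sym (trans (*-identityʳ (q * 1)) (*-identityʳ q))) q∤1)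
    where
    q≢0 = >-nonZero (≤-trans (s≤s z≤n) (prime≥2 pq))
    q∤1 : ¬ q ∣ 1
    q∤1 q∣1 = contradiction (∣1⇒≡1 q∣1) (>⇒≢ (prime≥2 pq))

  ν-mono : ∀ {q x y} → Prime q → .{{NonZero y}} → x ∣ y → ν q x ≤ ν q y
  ν-mono {q} {x} {y} pq (divides k y≡kx) = begin
    ν q x            ≤⟨ m≤n+m (ν q x) (ν q k) ⟩
    ν q k + ν q x    ≡⟨ ν-* pq k x {{k≢0}} {{x≢0}} ⟨
    ν q (k * x)      ≡⟨ cong (ν q) y≡kx ⟨
    ν q y            ∎
    where
    open ≤-Reasoning
    k≢0 = m*n≢0⇒m≢0 k {{subst NonZero y≡kx it}}
    x≢0 = m*n≢0⇒n≢0 k {{subst NonZero y≡kx it}}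

  ^∣⇒≤ν : ∀ {q e x} → 2 ≤ q → .{{NonZero x}} → q ^ e ∣ x → e ≤ ν q x
  ^∣⇒≤ν {q} {e} {x} q≥2 qᵉ∣x with e ≤? ν q x | ν-exact {q} x q≥2
  ... | yes e≤ν | _ = e≤ν
  ... | no e≰ν | exact r x≡ q∤r = contradiction (*-cancelˡ-∣ (q ^ ν q x) {{m^n≢0 q (ν q x) {{q≢0}}}} qᵛq∣qᵛr) q∤r
    where
    q≢0 = >-nonZero (≤-trans (s≤s z≤n) q≥2)
    qᵛ⁺¹∣qᵉ : q ^ suc (ν q x) ∣ q ^ e
    qᵛ⁺¹∣qᵉ = divides (q ^ (e ∸ suc (ν q x)))
      (trans (cong (q ^_) (sym (m∸n+n≡m (≰⇒> e≰ν)))) (^-distribˡ-+-* q (e ∸ suc (ν q x)) (suc (ν q x))))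
    qᵛq∣qᵛr : q ^ ν q x * q ∣ q ^ ν q x * r
    qᵛq∣qᵛr = subst₂ _∣_ (*-comm q _) x≡ (∣-trans qᵛ⁺¹∣qᵉ qᵉ∣x)

  ≤ν⇒^∣ : ∀ {q e x} → 2 ≤ q → .{{NonZero x}} → e ≤ ν q x → q ^ e ∣ x
  ≤ν⇒^∣ {q} {e} {x} q≥2 e≤ν with ν-exact {q} x q≥2
  ... | exact r x≡ _ = ∣-trans qᵉ∣qᵛ (divides r (trans x≡ (*-comm _ r)))
    where
    qᵉ∣qᵛ : q ^ e ∣ q ^ ν q x
    qᵉ∣qᵛ = divides (q ^ (ν q x ∸ e)) (trans (cong (q ^_) (sym (m∸n+n≡m e≤ν))) (^-distribˡ-+-* q (ν q x ∸ e) e))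

  ∣⇒ν≥1 : ∀ {q x} → 2 ≤ q → .{{NonZero x}} → q ∣ x → 1 ≤ ν q x
  ∣⇒ν≥1 {q} q≥2 q∣x = ^∣⇒≤ν q≥2 (subst (_∣ _) (sym (*-identityʳ q)) q∣x)

  ν≥1⇒∣ : ∀ {q x} → 2 ≤ q → .{{NonZero x}} → 1 ≤ ν q x → q ∣ x
  ν≥1⇒∣ {q} q≥2 ν≥1 = subst (_∣ _) (*-identityʳ q) (≤ν⇒^∣ q≥2 ν≥1)

  product-∣-by-ν : ∀ {ps} → All Prime ps → ∀ y → .{{NonZero y}} →
                   (∀ q → Prime q → ν q (product ps) ≤ ν q y) → product ps ∣ y
  product-∣-by-ν [] y _ = 1∣ y
  product-∣-by-ν {p ∷ ps} (pp ∷ pps) y ν≤ = subst (p * product ps ∣_) (sym y≡py′) (*-monoʳ-∣ p Π∣y′)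
    where
    instance
      p≢0 = >-nonZero (≤-trans (s≤s z≤n) (prime≥2 pp))
      Π≢0 = productOfPrimes≢0 pps
    ν-pΠ : ∀ {q} → Prime q → ν q (p * product ps) ≡ ν q p + ν q (product ps)
    ν-pΠ pq = ν-* pq p (product ps)
    p∣y : p ∣ y
    p∣y = ν≥1⇒∣ (prime≥2 pp) (≤-trans (≤-trans (≤-reflexive (sym (ν-self pp))) (m≤m+n _ _))
                                     (≤-trans (≤-reflexive (sym (ν-pΠ pp))) (ν≤ p pp)))
    y′ = quotient p∣y
    y≡py′ : y ≡ p * y′
    y≡py′ = trans (m∣n⇒n≡quotient*m p∣y) (*-comm y′ p)
    instance
      y′≢0 = m*n≢0⇒n≢0 p {{subst NonZero y≡py′ it}}
    Π∣y′ : product ps ∣ y′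
    Π∣y′ = product-∣-by-ν pps y′ λ q pq → +-cancelˡ-≤ (ν q p) _ _
      (subst₂ _≤_ (ν-pΠ pq) (trans (cong (ν q) y≡py′) (ν-* pq p y′)) (ν≤ q pq))

  ∣-by-ν : ∀ {x y} → .{{NonZero x}} → .{{NonZero y}} → (∀ q → Prime q → ν q x ≤ ν q y) → x ∣ y
  ∣-by-ν {x} {y} ν≤ = subst (_∣ y) (sym x≡Π) (product-∣-by-ν factorsPrime y
    (λ q pq → subst (λ z → ν q z ≤ ν q y) x≡Π (ν≤ q pq)))
    where
    F = factorise x
    open PrimeFactorisation F
    x≡Π : x ≡ product factors
    x≡Π = isFactorisation

  ν-*-* : ∀ {q} → Prime q → ∀ x y z → .{{NonZero x}} → .{{NonZero y}} → .{{NonZero z}} →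
          ν q (x * y * z) ≡ ν q x + ν q y + ν q z
  ν-*-* pq x y z = trans (ν-* pq (x * y) z {{m*n≢0 x y}}) (cong (_+ ν _ z) (ν-* pq x y))


module Coprimality where

  open import Data.Nat.Base
  open import Data.Nat.Properties
  open import Data.Nat.Divisibility
  open import Data.Nat.Primality using (Prime; prime[2]; euclidsLemma)
  open import Data.Nat.Coprimality using (Coprime; coprime⇒gcd≡1; coprime-+; 1-coprimeTo)
  import Data.Nat.Coprimality as Coprime
  open import Data.Nat.GCD using (gcd; c*gcd[m,n]≡gcd[cm,cn])
  open import Data.Nat.LCM using (lcm; gcd*lcm; lcm-least)
  open import Data.Empty using (⊥)
  open import Data.Product.Base using (_,_)
  open import Data.Sum.Base using (inj₁; inj₂)
  open import Relation.Nullary.Negation using (contradiction)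
  open import Function.Base using (case_of_)
  open import Relation.Binary.PropositionalEquality
  open Arithmetic using (prime≥2)
  open Valuation

  coprime-by-primes : ∀ {m n} → (∀ q → Prime q → q ∣ m → q ∣ n → ⊥) → Coprime m n
  coprime-by-primes {m} {n} no-common {zero} (0∣m , 0∣n) =
    contradiction (subst (2 ∣_) (sym (0∣⇒≡0 0∣m)) (2 ∣0) , subst (2 ∣_) (sym (0∣⇒≡0 0∣n)) (2 ∣0))
                  (λ (2∣m , 2∣n) → no-common 2 prime[2] 2∣m 2∣n)
  coprime-by-primes {m} {n} no-common {d@(suc _)} (d∣m , d∣n) = ∣1⇒≡1 (∣-by-ν ν≤)
    where
    ν≤ : ∀ q → Prime q → ν q d ≤ ν q 1
    ν≤ q pq = subst (_≤ ν q 1) (sym (ν-∤ (prime≥2 pq) λ q∣d → no-common q pq (∣-trans q∣d d∣m) (∣-trans q∣d d∣n))) z≤n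

  coprime-prime : ∀ {m n q} → Coprime m n → Prime q → q ∣ m → q ∣ n → ⊥
  coprime-prime cop pq q∣m q∣n = contradiction (cop (q∣m , q∣n)) (>⇒≢ (prime≥2 pq))

  coprime-*-∣ : ∀ {m n k} → Coprime m n → m ∣ k → n ∣ k → m * n ∣ k
  coprime-*-∣ {m} {n} cop m∣k n∣k = subst (_∣ _) lcm≡mn (lcm-least m∣k n∣k)
    where
    lcm≡mn : lcm m n ≡ m * n
    lcm≡mn = trans (sym (*-identityˡ (lcm m n)))
                   (trans (cong (_* lcm m n) (sym (coprime⇒gcd≡1 cop))) (gcd*lcm m n))

  coprime-*ˡ : ∀ {m n k} → Coprime m k → Coprime n k → Coprime (m * n) k
  coprime-*ˡ {m} {n} m⊥k n⊥k = coprime-by-primes λ q pq q∣mn q∣k → case euclidsLemma m n pq q∣mn of λ where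
    (inj₁ q∣m) → coprime-prime m⊥k pq q∣m q∣k
    (inj₂ q∣n) → coprime-prime n⊥k pq q∣n q∣k

  coprime-suc : ∀ n → Coprime n (suc n)
  coprime-suc n = Coprime.sym (subst (λ k → Coprime k n) (+-comm n 1) (coprime-+ (1-coprimeTo n)))

  gcd-*-coprime : ∀ c {m n} → Coprime m n → gcd (c * m) (c * n) ≡ c
  gcd-*-coprime c {m} {n} cop = trans (sym (c*gcd[m,n]≡gcd[cm,cn] c m n)) (trans (cong (c *_) (coprime⇒gcd≡1 cop)) (*-identityʳ c))

  coprime-*-*-∣ : ∀ {i j k s} → Coprime i j → Coprime i k → Coprime j k → i ∣ s → j ∣ s → k ∣ s → i * j * k ∣ s
  coprime-*-*-∣ i⊥j i⊥k j⊥k i∣s j∣s k∣s = coprime-*-∣ (coprime-*ˡ i⊥k j⊥k) (coprime-*-∣ i⊥j i∣s j∣s) k∣s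

module LucasIdentities (a b : ℤ.ℤ) where

  open import Data.Integer.Base using (ℤ; +_; _+_; _*_; -_; _-_; _^_)
  open import Data.Nat.Base as ℕ using (ℕ; zero; suc)
  import Data.Nat.Properties as ℕ
  open import Data.Integer.Tactic.RingSolver using (solve-∀)
  open import Data.Product.Base using (∃; _,_)
  open import Relation.Binary.PropositionalEquality
  open import Defs using (U; V)

  U-+ : ∀ m n → U a b (m ℕ.+ suc n) ≡ U a b (suc m) * U a b (suc n) + b * U a b m * U a b n
  U-+ zero n = lemma (U a b (suc n)) b (U a b n)
    where
    lemma : ∀ x y z → x ≡ + 1 * x + y * + 0 * z
    lemma = solve-∀
  U-+ (suc zero) n = lemma a b (U a b (suc n)) (U a b n)
    where
    lemma : ∀ a b x y → a * x + b * y ≡ (a * + 1 + b * + 0) * x + b * + 1 * y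
    lemma = solve-∀
  U-+ (suc (suc m)) n = begin
    a * U a b (suc m ℕ.+ suc n) + b * U a b (m ℕ.+ suc n)
      ≡⟨ cong₂ (λ x y → a * x + b * y) (U-+ (suc m) n) (U-+ m n) ⟩
    a * (U a b (2 ℕ.+ m) * U a b (suc n) + b * U a b (suc m) * U a b n)
      + b * (U a b (suc m) * U a b (suc n) + b * U a b m * U a b n)
      ≡⟨ lemma a b (U a b (2 ℕ.+ m)) (U a b (suc m)) (U a b m) (U a b (suc n)) (U a b n) ⟩
    (a * U a b (2 ℕ.+ m) + b * U a b (suc m)) * U a b (suc n)
      + b * (a * U a b (suc m) + b * U a b m) * U a b n ∎
    where
    open ≡-Reasoning
    lemma : ∀ a b x₂ x₁ x₀ y₁ y₀ → a * (x₂ * y₁ + b * x₁ * y₀) + b * (x₁ * y₁ + b * x₀ * y₀)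
                                 ≡ (a * x₂ + b * x₁) * y₁ + b * (a * x₁ + b * x₀) * y₀
    lemma = solve-∀

  V≡U+bU : ∀ n → V a b (suc n) ≡ U a b (2 ℕ.+ n) + b * U a b n
  V≡U+bU zero = lemma a b
    where
    lemma : ∀ a b → a ≡ a * + 1 + b * + 0 + b * + 0
    lemma = solve-∀
  V≡U+bU (suc zero) = lemma a b
    where
    lemma : ∀ a b → a * a + b * + 2 ≡ a * (a * + 1 + b * + 0) + b * + 1 + b * + 1
    lemma = solve-∀
  V≡U+bU (suc (suc n)) = begin
    a * V a b (2 ℕ.+ n) + b * V a b (suc n)
      ≡⟨ cong₂ (λ x y → a * x + b * y) (V≡U+bU (suc n)) (V≡U+bU n) ⟩
    a * (U a b (3 ℕ.+ n) + b * U a b (suc n)) + b * (U a b (2 ℕ.+ n) + b * U a b n)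
      ≡⟨ lemma a b (U a b (3 ℕ.+ n)) (U a b (2 ℕ.+ n)) (U a b (suc n)) (U a b n) ⟩
    (a * U a b (3 ℕ.+ n) + b * U a b (2 ℕ.+ n)) + b * (a * U a b (suc n) + b * U a b n) ∎
    where
    open ≡-Reasoning
    lemma : ∀ a b x₃ x₂ x₁ x₀ → a * (x₃ + b * x₁) + b * (x₂ + b * x₀) ≡ (a * x₃ + b * x₂) + b * (a * x₁ + b * x₀)
    lemma = solve-∀

  V≡2U-aU : ∀ n → V a b n ≡ + 2 * U a b (suc n) - a * U a b n
  V≡2U-aU zero = lemma a
    where
    lemma : ∀ a → + 2 ≡ + 2 * + 1 - a * + 0
    lemma = solve-∀
  V≡2U-aU (suc n) = trans (V≡U+bU n) (lemma a b (U a b (suc n)) (U a b n))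
    where
    lemma : ∀ a b x₁ x₀ → (a * x₁ + b * x₀) + b * x₀ ≡ + 2 * (a * x₁ + b * x₀) - a * x₁
    lemma = solve-∀

  U-double : ∀ n → U a b (n ℕ.+ n) ≡ U a b n * V a b n
  U-double zero = refl
  U-double (suc n) = begin
    U a b (suc n ℕ.+ suc n)                                   ≡⟨ U-+ (suc n) n ⟩
    U a b (2 ℕ.+ n) * U a b (suc n) + b * U a b (suc n) * U a b n  ≡⟨ lemma b (U a b (2 ℕ.+ n)) (U a b (suc n)) (U a b n) ⟩
    U a b (suc n) * (U a b (2 ℕ.+ n) + b * U a b n)           ≡⟨ cong (U a b (suc n) *_) (V≡U+bU n) ⟨
    U a b (suc n) * V a b (suc n)                             ∎
    where
    open ≡-Reasoning
    lemma : ∀ b x₂ x₁ x₀ → x₂ * x₁ + b * x₁ * x₀ ≡ x₁ * (x₂ + b * x₀)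
    lemma = solve-∀

  cassini : ∀ n → U a b (suc n) * U a b (suc n) - U a b (2 ℕ.+ n) * U a b n ≡ (- b) ^ n
  cassini zero = lemma a b
    where
    lemma : ∀ a b → + 1 * + 1 - (a * + 1 + b * + 0) * + 0 ≡ + 1
    lemma = solve-∀
  cassini (suc n) = trans (lemma a b (U a b (suc n)) (U a b n)) (cong (- b *_) (cassini n))
    where
    lemma : ∀ a b x₁ x₀ → (a * x₁ + b * x₀) * (a * x₁ + b * x₀) - (a * (a * x₁ + b * x₀) + b * x₁) * x₁
                        ≡ - b * (x₁ * x₁ - (a * x₁ + b * x₀) * x₀)
    lemma = solve-∀

  V-double : ∀ n → V a b (n ℕ.+ n) ≡ V a b n * V a b n - + 2 * (- b) ^ n
  V-double zero = refl
  V-double (suc n) = begin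
    V a b (suc (n ℕ.+ suc n))
      ≡⟨ V≡U+bU (n ℕ.+ suc n) ⟩
    U a b (suc (suc (n ℕ.+ suc n))) + b * U a b (n ℕ.+ suc n)
      ≡⟨ cong (λ i → U a b (suc i) + b * U a b (n ℕ.+ suc n)) (ℕ.+-suc n (suc n)) ⟨
    U a b (suc n ℕ.+ suc (suc n)) + b * U a b (n ℕ.+ suc n)
      ≡⟨ cong₂ (λ x y → x + b * y) (U-+ (suc n) (suc n)) (U-+ n n) ⟩
    (x₂ * x₂ + b * x₁ * x₁) + b * (x₁ * x₁ + b * x₀ * x₀)
      ≡⟨ lemma b x₂ x₁ x₀ ⟩
    (x₂ + b * x₀) * (x₂ + b * x₀) - + 2 * ((- b) * (x₁ * x₁ - x₂ * x₀))
      ≡⟨ cong₂ (λ y z → y * y - + 2 * ((- b) * z)) (sym (V≡U+bU n)) (cassini n) ⟩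
    V a b (suc n) * V a b (suc n) - + 2 * (- b) ^ suc n ∎
    where
    open ≡-Reasoning
    x₂ = U a b (2 ℕ.+ n)
    x₁ = U a b (suc n)
    x₀ = U a b n
    lemma : ∀ b x₂ x₁ x₀ → (x₂ * x₂ + b * x₁ * x₁) + b * (x₁ * x₁ + b * x₀ * x₀)
                         ≡ (x₂ + b * x₀) * (x₂ + b * x₀) - + 2 * ((- b) * (x₁ * x₁ - x₂ * x₀))
    lemma = solve-∀

  -- The quotient ω k = U (k d) / U d for d = e + 1, expanded modulo U d and (U d)²;
  -- these expansions drive the lifting-the-exponent lemma.
  module Block (e : ℕ) where

    d : ℕ
    d = suc e

    X Y c : ℤ
    X = U a b d
    Y = b * U a b e
    c = U a b (suc d)

    R : ℕ → ℤ
    R k = U a b (suc (k ℕ.* d))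

    ω : ℕ → ℤ
    ω zero = + 0
    ω (suc k) = R k + Y * ω k

    U-step : ∀ k → U a b (suc k ℕ.* d) ≡ R k * X + Y * U a b (k ℕ.* d)
    U-step k = begin
      U a b (d ℕ.+ k ℕ.* d)                 ≡⟨ cong (U a b) (ℕ.+-comm d (k ℕ.* d)) ⟩
      U a b (k ℕ.* d ℕ.+ suc e)             ≡⟨ U-+ (k ℕ.* d) e ⟩
      R k * X + b * U a b (k ℕ.* d) * U a b e ≡⟨ cong (λ z → R k * X + z) (lemma b (U a b (k ℕ.* d)) (U a b e)) ⟩
      R k * X + Y * U a b (k ℕ.* d)         ∎
      where
      open ≡-Reasoning
      lemma : ∀ b x y → b * x * y ≡ b * y * x
      lemma = solve-∀

    R-step : ∀ k → R (suc k) ≡ R k * c + b * U a b (k ℕ.* d) * X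
    R-step k = begin
      U a b (suc (d ℕ.+ k ℕ.* d))   ≡⟨ cong (U a b) (trans (cong suc (ℕ.+-comm d (k ℕ.* d))) (sym (ℕ.+-suc (k ℕ.* d) d))) ⟩
      U a b (k ℕ.* d ℕ.+ suc d)     ≡⟨ U-+ (k ℕ.* d) d ⟩
      R k * c + b * U a b (k ℕ.* d) * X ∎
      where open ≡-Reasoning

    U-block : ∀ k → U a b (k ℕ.* d) ≡ X * ω k
    U-block zero = lemma X
      where
      lemma : ∀ x → + 0 ≡ x * + 0
      lemma = solve-∀
    U-block (suc k) = begin
      U a b (suc k ℕ.* d)             ≡⟨ U-step k ⟩
      R k * X + Y * U a b (k ℕ.* d)   ≡⟨ cong (λ z → R k * X + Y * z) (U-block k) ⟩
      R k * X + Y * (X * ω k)         ≡⟨ lemma (R k) X Y (ω k) ⟩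
      X * (R k + Y * ω k)             ∎
      where
      open ≡-Reasoning
      lemma : ∀ r x y w → r * x + y * (x * w) ≡ x * (r + y * w)
      lemma = solve-∀

    R-mod-X : ∀ k → ∃ λ r → R k ≡ Y ^ k + r * X
    R-mod-X zero = + 0 , lemma X
      where
      lemma : ∀ x → + 1 ≡ + 1 + + 0 * x
      lemma = solve-∀
    R-mod-X (suc k) with R-mod-X k
    ... | r , Rk≡ = r * c + a * Y ^ k + b * U a b (k ℕ.* d) , (begin
      R (suc k)                                   ≡⟨ R-step k ⟩
      R k * c + b * U a b (k ℕ.* d) * X           ≡⟨ cong (λ z → z * c + b * U a b (k ℕ.* d) * X) Rk≡ ⟩
      (Y ^ k + r * X) * c + b * U a b (k ℕ.* d) * X ≡⟨ lemma a X Y (Y ^ k) r b (U a b (k ℕ.* d)) ⟩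
      Y * Y ^ k + (r * (a * X + Y) + a * Y ^ k + b * U a b (k ℕ.* d)) * X ∎)
      where
      open ≡-Reasoning
      lemma : ∀ a x y yᵏ r b p → (yᵏ + r * x) * (a * x + y) + b * p * x ≡ y * yᵏ + (r * (a * x + y) + a * yᵏ + b * p) * x
      lemma = solve-∀

    R-mod-X² : ∀ k → ∃ λ r → R k ≡ c ^ k + r * (X * X)
    R-mod-X² zero = + 0 , lemma X
      where
      lemma : ∀ x → + 1 ≡ + 1 + + 0 * (x * x)
      lemma = solve-∀
    R-mod-X² (suc k) with R-mod-X² k
    ... | r , Rk≡ = r * c + b * ω k , (begin
      R (suc k)                                   ≡⟨ R-step k ⟩
      R k * c + b * U a b (k ℕ.* d) * X           ≡⟨ cong₂ (λ z w → z * c + b * w * X) Rk≡ (U-block k) ⟩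
      (c ^ k + r * (X * X)) * c + b * (X * ω k) * X ≡⟨ lemma X c (c ^ k) r b (ω k) ⟩
      c * c ^ k + (r * c + b * ω k) * (X * X)     ∎)
      where
      open ≡-Reasoning
      lemma : ∀ x c cᵏ r b w → (cᵏ + r * (x * x)) * c + b * (x * w) * x ≡ c * cᵏ + (r * c + b * w) * (x * x)
      lemma = solve-∀

    c^k-mod-X² : ∀ k → ∃ λ r → c ^ suc k ≡ Y ^ suc k + + suc k * a * X * Y ^ k + r * (X * X)
    c^k-mod-X² zero = + 0 , lemma a X Y
      where
      lemma : ∀ a x y → (a * x + y) * + 1 ≡ y * + 1 + + 1 * a * x * + 1 + + 0 * (x * x)
      lemma = solve-∀
    c^k-mod-X² (suc k) with c^k-mod-X² k
    ... | r , cᵏ≡ = a * a * + suc k * Y ^ k + (a * X + Y) * r , (begin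
      c * c ^ suc k           ≡⟨ cong (c *_) cᵏ≡ ⟩
      (a * X + Y) * (Y ^ suc k + + suc k * a * X * Y ^ k + r * (X * X))
        ≡⟨ lemma a X Y (Y ^ k) (+ suc k) r ⟩
      Y * Y ^ suc k + (+ 1 + + suc k) * a * X * Y ^ suc k + (a * a * + suc k * Y ^ k + (a * X + Y) * r) * (X * X) ∎)
      where
      open ≡-Reasoning
      lemma : ∀ a x y yᵏ n r → (a * x + y) * (y * yᵏ + n * a * x * yᵏ + r * (x * x))
                             ≡ y * (y * yᵏ) + (+ 1 + n) * a * x * (y * yᵏ) + (a * a * n * yᵏ + (a * x + y) * r) * (x * x)
      lemma = solve-∀

    ω-mod-X : ∀ k → ∃ λ r → ω (suc k) ≡ + suc k * Y ^ k + r * X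
    ω-mod-X zero = + 0 , lemma X Y
      where
      lemma : ∀ x y → + 1 + y * + 0 ≡ + 1 * + 1 + + 0 * x
      lemma = solve-∀
    ω-mod-X (suc k) with R-mod-X (suc k) | ω-mod-X k
    ... | r , R≡ | s , ω≡ = r + Y * s , (begin
      R (suc k) + Y * ω (suc k)  ≡⟨ cong₂ (λ z w → z + Y * w) R≡ ω≡ ⟩
      Y * Y ^ k + r * X + Y * (+ suc k * Y ^ k + s * X) ≡⟨ lemma X Y (Y ^ k) (+ suc k) r s ⟩
      (+ 1 + + suc k) * (Y * Y ^ k) + (r + Y * s) * X ∎)
      where
      open ≡-Reasoning
      lemma : ∀ x y yᵏ n r s → y * yᵏ + r * x + y * (n * yᵏ + s * x) ≡ (+ 1 + n) * (y * yᵏ) + (r + y * s) * x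
      lemma = solve-∀

    ω-mod-X² : ∀ k → ∃ λ r → + 2 * Y * ω (suc k) ≡ + 2 * + suc k * Y ^ suc k + + suc k * + k * a * X * Y ^ k + r * (X * X)
    ω-mod-X² zero = + 0 , lemma a X Y
      where
      lemma : ∀ a x y → + 2 * y * (+ 1 + y * + 0) ≡ + 2 * + 1 * (y * + 1) + + 1 * + 0 * a * x * + 1 + + 0 * (x * x)
      lemma = solve-∀
    ω-mod-X² (suc k) with R-mod-X² (suc k) | c^k-mod-X² k | ω-mod-X² k
    ... | r , R≡ | s , cᵏ≡ | t , ω≡ = + 2 * Y * (r + s) + Y * t , (begin
      + 2 * Y * (R (suc k) + Y * ω (suc k))
        ≡⟨ lemma₁ Y (R (suc k)) (ω (suc k)) ⟩
      + 2 * Y * R (suc k) + Y * (+ 2 * Y * ω (suc k))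
        ≡⟨ cong₂ (λ z w → + 2 * Y * z + Y * w) (trans R≡ (cong (_+ r * (X * X)) cᵏ≡)) ω≡ ⟩
      + 2 * Y * (Y * Y ^ k + + suc k * a * X * Y ^ k + s * (X * X) + r * (X * X))
        + Y * (+ 2 * + suc k * (Y * Y ^ k) + + suc k * + k * a * X * Y ^ k + t * (X * X))
        ≡⟨ lemma₂ a X Y (Y ^ k) (+ k) r s t ⟩
      + 2 * (+ 1 + + suc k) * (Y * (Y * Y ^ k)) + (+ 1 + + suc k) * + suc k * a * X * (Y * Y ^ k)
        + (+ 2 * Y * (r + s) + Y * t) * (X * X) ∎)
      where
      open ≡-Reasoning
      lemma₁ : ∀ y r w → + 2 * y * (r + y * w) ≡ + 2 * y * r + y * (+ 2 * y * w)
      lemma₁ = solve-∀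
      lemma₂ : ∀ a x y yᵏ m r s t →
        + 2 * y * (y * yᵏ + (+ 1 + m) * a * x * yᵏ + s * (x * x) + r * (x * x))
          + y * (+ 2 * (+ 1 + m) * (y * yᵏ) + (+ 1 + m) * m * a * x * yᵏ + t * (x * x))
        ≡ + 2 * (+ 1 + (+ 1 + m)) * (y * (y * yᵏ)) + (+ 1 + (+ 1 + m)) * (+ 1 + m) * a * x * (y * yᵏ)
          + (+ 2 * y * (r + s) + y * t) * (x * x)
      lemma₂ = solve-∀


module LucasSequence (a b : ℤ.ℤ) (a⊥b : ℤ.Coprime a b) (b≢0 : b ≢ ℤ.+ 0) (a>0 : a ℤ.> ℤ.+ 0)
                     (Δ>0 : a ℤ.* a ℤ.+ ℤ.+ 4 ℤ.* b ℤ.> ℤ.+ 0) where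

  open import Data.Nat.Base as ℕ using (ℕ; zero; suc; NonZero; z≤n; s≤s)
  import Data.Nat.Properties as ℕ
  open import Data.Integer.Base
    using (ℤ; +_; +[1+_]; -[1+_]; +0; _+_; _*_; -_; _-_; _^_; _>_; ∣_∣; Positive; NonNegative; +<+)
  open import Data.Integer.Properties using (pos-*; abs-*; +-injective; ∣-i∣≡∣i∣)
  open import Data.Integer.Tactic.RingSolver using (solve-∀)
  import Data.Nat.Tactic.RingSolver as ℕ-Solver
  open import Data.Product.Base using (_×_; _,_; proj₁; proj₂)
  open import Relation.Binary.PropositionalEquality
  open import Relation.Nullary.Negation using (contradiction)
  open import Relation.Nullary using (¬_; yes; no)
  open import Function.Base using (case_of_; it)
  open import Data.Sum.Base using (_⊎_; inj₁; inj₂; [_,_]′; map₂)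
  open import Data.Nat.Divisibility
  import Data.Integer.Divisibility.Signed as ℤ
  open import Data.Nat.Primality using (Prime; euclidsLemma; prime[2]; prime⇒nonZero)
  open import Data.Nat.Coprimality using (Coprime; coprime-divisor; coprime⇒gcd≡1)
  open import Data.Nat.GCD using (gcd; gcd-GCD; module Bézout; c*gcd[m,n]≡gcd[cm,cn])
  open import Data.Nat.DivMod using (_%_; _/_; m≡m%n+[m/n]*n; m%n<n)
  open import Defs using (U; V)
  open LucasIdentities a b
  open Arithmetic using (prime≥2)
  open Valuation
  open Coprimality using (coprime-by-primes)

  private
    half-positive : ∀ {x} → Positive (+ 2 * x) → Positive x
    half-positive {+[1+ m ]} _ = _
    half-positive {+0} ()
    half-positive { -[1+ m ]} ()

    pos+nonNeg : ∀ {x y} → Positive x → NonNegative y → Positive (x + y)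
    pos+nonNeg {+[1+ m ]} {+ n} _ _ = _

    pos*pos : ∀ {x y} → Positive x → Positive y → Positive (x * y)
    pos*pos {+[1+ m ]} {+[1+ n ]} _ _ = _

    nonNeg*nonNeg : ∀ {x y} → NonNegative x → NonNegative y → NonNegative (x * y)
    nonNeg*nonNeg {+ m} {+ n} _ _ = subst NonNegative (pos-* m n) _

    pos⇒nonNeg : ∀ {x} → Positive x → NonNegative x
    pos⇒nonNeg {+[1+ m ]} _ = _

    >0⇒pos : ∀ {x} → x > + 0 → Positive x
    >0⇒pos {+[1+ m ]} _ = _
    >0⇒pos {+0} (+<+ ())

  a-pos : Positive a
  a-pos = >0⇒pos a>0

  -- V n = 2 U (n + 1) - a U n, and both recurrences below have positive coefficients.
  positivity : ∀ n → NonNegative (U a b n) × Positive (U a b (suc n)) × Positive (V a b n)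
  positivity zero = _ , _ , _
  positivity (suc n) with positivity n
  ... | Uₙ≥0 , Uₙ₊₁>0 , Vₙ>0 = pos⇒nonNeg Uₙ₊₁>0 , Uₙ₊₂>0 , Vₙ₊₁>0
    where
    Vₙ₊₁>0 : Positive (V a b (suc n))
    Vₙ₊₁>0 = half-positive (subst Positive (sym 2Vₙ₊₁≡)
                              (pos+nonNeg (pos*pos a-pos Vₙ>0) (nonNeg*nonNeg (pos⇒nonNeg (>0⇒pos Δ>0)) Uₙ≥0)))
      where
      2Vₙ₊₁≡ : + 2 * V a b (suc n) ≡ a * V a b n + (a * a + + 4 * b) * U a b n
      2Vₙ₊₁≡ = trans (cong (+ 2 *_) (V≡2U-aU (suc n)))
               (trans (lemma a b (U a b (suc n)) (U a b n)) (cong (λ v → a * v + (a * a + + 4 * b) * U a b n) (sym (V≡2U-aU n))))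
        where
        lemma : ∀ a b x₁ x₀ → + 2 * (+ 2 * (a * x₁ + b * x₀) - a * x₁) ≡ a * (+ 2 * x₁ - a * x₀) + (a * a + + 4 * b) * x₀
        lemma = solve-∀
    Uₙ₊₂>0 : Positive (U a b (2 ℕ.+ n))
    Uₙ₊₂>0 = half-positive (subst Positive (sym 2Uₙ₊₂≡) (pos+nonNeg Vₙ₊₁>0 (pos⇒nonNeg (pos*pos a-pos Uₙ₊₁>0))))
      where
      2Uₙ₊₂≡ : + 2 * U a b (2 ℕ.+ n) ≡ V a b (suc n) + a * U a b (suc n)
      2Uₙ₊₂≡ = trans (lemma a (U a b (2 ℕ.+ n)) (U a b (suc n))) (cong (_+ a * U a b (suc n)) (sym (V≡2U-aU (suc n))))
        where
        lemma : ∀ a x y → + 2 * x ≡ + 2 * x - a * y + a * y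
        lemma = solve-∀

  u v : ℕ → ℕ
  u n = ∣ U a b n ∣
  v n = ∣ V a b n ∣

  private
    nonNeg⇒≡∣∣ : ∀ {x} → NonNegative x → x ≡ + ∣ x ∣
    nonNeg⇒≡∣∣ {+ n} _ = refl

    pos⇒∣∣-nonZero : ∀ {x} → Positive x → NonZero ∣ x ∣
    pos⇒∣∣-nonZero {+[1+ m ]} _ = _

  U≡u : ∀ n → U a b n ≡ + u n
  U≡u n = nonNeg⇒≡∣∣ (proj₁ (positivity n))

  V≡v : ∀ n → V a b n ≡ + v n
  V≡v n = nonNeg⇒≡∣∣ (pos⇒nonNeg (proj₂ (proj₂ (positivity n))))

  u-nonZero : ∀ n → .{{NonZero n}} → NonZero (u n)
  u-nonZero (suc n) = pos⇒∣∣-nonZero (proj₁ (proj₂ (positivity n)))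

  v-nonZero : ∀ n → NonZero (v n)
  v-nonZero n = pos⇒∣∣-nonZero (proj₂ (proj₂ (positivity n)))

  private
    positive-difference : ∀ {m n} → Positive (+ m - + n) → n ℕ.< m
    positive-difference {m} {n} pos with + m - + n in eq
    ... | +[1+ k ] = subst (n ℕ.<_) (sym (+-injective m≡)) (s≤s (ℕ.m≤n+m n k))
      where
      lemma : ∀ x y → x ≡ (x - y) + y
      lemma = solve-∀
      m≡ : + m ≡ + (suc k ℕ.+ n)
      m≡ = trans (lemma (+ m) (+ n)) (cong (_+ + n) eq)

    a≡1⇒b-pos : a ≡ + 1 → Positive b
    a≡1⇒b-pos a≡1 = go b b≢0 (subst (λ x → Positive (x * x + + 4 * b)) a≡1 (>0⇒pos Δ>0))
      where
      go : ∀ b → b ≢ + 0 → Positive (+ 1 * + 1 + + 4 * b) → Positive b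
      go +[1+ k ] _ _ = _
      go +0 b≢0 _ = contradiction refl b≢0
      go -[1+ k ] _ pos with + 1 * + 1 + + 4 * -[1+ k ] in eq | pos
      ... | +[1+ j ] | _ = contradiction (ℕ.suc-injective (+-injective (lemma (+[1+ j ]) (+[1+ k ]) (sym eq)))) (ℕ.m+1+n≢0 j)
        where
        lemma : ∀ x s → x ≡ + 1 * + 1 + + 4 * (- s) → x + + 4 * s ≡ + 1
        lemma x s x≡ = trans (cong (_+ + 4 * s) x≡) (lemma′ s)
          where
          lemma′ : ∀ s → + 1 * + 1 + + 4 * (- s) + + 4 * s ≡ + 1
          lemma′ = solve-∀

    U-increment : ∀ n → Positive (U a b (3 ℕ.+ n) - U a b (2 ℕ.+ n))
    U-increment n = by-cases a refl
      where
      by-cases : ∀ a′ → a ≡ a′ → Positive (U a b (3 ℕ.+ n) - U a b (2 ℕ.+ n))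
      by-cases +0 a≡ = contradiction (subst Positive a≡ a-pos) λ ()
      by-cases -[1+ _ ] a≡ = contradiction (subst Positive a≡ a-pos) λ ()
      by-cases +[1+ zero ] a≡ = subst Positive (sym diff≡bU) (pos*pos (a≡1⇒b-pos a≡) (proj₁ (proj₂ (positivity n))))
        where
        diff≡bU : U a b (3 ℕ.+ n) - U a b (2 ℕ.+ n) ≡ b * U a b (suc n)
        diff≡bU = trans (cong (λ x → x * U a b (2 ℕ.+ n) + b * U a b (suc n) - U a b (2 ℕ.+ n)) a≡)
                        (lemma b (U a b (2 ℕ.+ n)) (U a b (suc n)))
          where
          lemma : ∀ b y z → + 1 * y + b * z - y ≡ b * z
          lemma = solve-∀
      by-cases +[1+ suc m ] a≡ = half-positive (subst Positive (sym 2diff≡) (pos+nonNeg (proj₂ (proj₂ (positivity (2 ℕ.+ n))))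
                                                      (nonNeg*nonNeg {+ m} _ (proj₁ (positivity (2 ℕ.+ n))))))
        where
        2diff≡ : + 2 * (U a b (3 ℕ.+ n) - U a b (2 ℕ.+ n)) ≡ V a b (2 ℕ.+ n) + + m * U a b (2 ℕ.+ n)
        2diff≡ = begin
          + 2 * (U a b (3 ℕ.+ n) - U a b (2 ℕ.+ n))
            ≡⟨ lemma a (U a b (3 ℕ.+ n)) (U a b (2 ℕ.+ n)) ⟩
          (+ 2 * U a b (3 ℕ.+ n) - a * U a b (2 ℕ.+ n)) + (a - + 2) * U a b (2 ℕ.+ n)
            ≡⟨ cong₂ (λ v x → v + (x - + 2) * U a b (2 ℕ.+ n)) (sym (V≡2U-aU (2 ℕ.+ n))) a≡ ⟩
          V a b (2 ℕ.+ n) + (+ (2 ℕ.+ m) - + 2) * U a b (2 ℕ.+ n)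
            ≡⟨ cong (λ x → V a b (2 ℕ.+ n) + x * U a b (2 ℕ.+ n)) (lemma′ (+ m)) ⟩
          V a b (2 ℕ.+ n) + + m * U a b (2 ℕ.+ n) ∎
          where
          open ≡-Reasoning
          lemma : ∀ a x y → + 2 * (x - y) ≡ (+ 2 * x - a * y) + (a - + 2) * y
          lemma = solve-∀
          lemma′ : ∀ m → (+ 2 + m) - + 2 ≡ m
          lemma′ = solve-∀

  u-<-step : ∀ n → u (2 ℕ.+ n) ℕ.< u (3 ℕ.+ n)
  u-<-step n = positive-difference (subst₂ (λ x y → Positive (x - y)) (U≡u (3 ℕ.+ n)) (U≡u (2 ℕ.+ n)) (U-increment n))

  u-≤-step : ∀ n → u (suc n) ℕ.≤ u (2 ℕ.+ n)
  u-≤-step zero = ℕ.>-nonZero⁻¹ (u 2) {{u-nonZero 2}}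
  u-≤-step (suc n) = ℕ.<⇒≤ (u-<-step n)

  u-≤-mono : ∀ {t j} → 1 ℕ.≤ t → t ℕ.≤ j → u t ℕ.≤ u j
  u-≤-mono {suc t} {suc j} _ (s≤s t≤j) with ℕ.m≤n⇒∃[o]m+o≡n t≤j
  ... | k , refl = go t k
    where
    go : ∀ t k → u (suc t) ℕ.≤ u (suc (t ℕ.+ k))
    go t zero = ℕ.≤-reflexive (cong (λ i → u (suc i)) (sym (ℕ.+-identityʳ t)))
    go t (suc k) = ℕ.≤-trans (go t k) (subst (λ i → u (suc (t ℕ.+ k)) ℕ.≤ u (suc i)) (sym (ℕ.+-suc t k)) (u-≤-step (t ℕ.+ k)))

  u-<-mono : ∀ {t j} → 1 ℕ.≤ t → t ℕ.< j → 3 ℕ.≤ j → u t ℕ.< u j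
  u-<-mono {t} {suc (suc (suc j))} 1≤t (s≤s t≤2+j) _ = ℕ.≤-<-trans (u-≤-mono 1≤t t≤2+j) (u-<-step j)
  u-<-mono {j = 1} _ _ (s≤s ())
  u-<-mono {j = 2} _ _ (s≤s (s≤s ()))

  private
    ∣ℤ⇒∣ : ∀ {q z} → + q ℤ.∣ z → q ∣ ∣ z ∣
    ∣ℤ⇒∣ = ℤ.∣⇒∣ᵤ

    ∣⇒∣ℤ : ∀ {q z} → q ∣ ∣ z ∣ → + q ℤ.∣ z
    ∣⇒∣ℤ = ℤ.∣ᵤ⇒∣

    euclidsLemmaℤ : ∀ {q} x y → Prime q → + q ℤ.∣ x * y → + q ℤ.∣ x ⊎ + q ℤ.∣ y
    euclidsLemmaℤ x y pq q∣xy with euclidsLemma ∣ x ∣ ∣ y ∣ pq (subst (_ ∣_) (abs-* x y) (∣ℤ⇒∣ q∣xy))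
    ... | inj₁ q∣x = inj₁ (∣⇒∣ℤ q∣x)
    ... | inj₂ q∣y = inj₂ (∣⇒∣ℤ q∣y)

    prime∤1 : ∀ {q} → Prime q → ¬ + q ℤ.∣ + 1
    prime∤1 pq q∣1 = contradiction (∣1⇒≡1 (∣ℤ⇒∣ q∣1)) (ℕ.>⇒≢ (prime≥2 pq))

  prime∣b⇒∤U : ∀ {q} → Prime q → + q ℤ.∣ b → ∀ n → ¬ + q ℤ.∣ U a b (suc n)
  prime∣b⇒∤U pq q∣b zero = prime∤1 pq
  prime∣b⇒∤U pq q∣b (suc n) q∣U
    with euclidsLemmaℤ a (U a b (suc n)) pq (ℤ.∣m+n∣n⇒∣m q∣U (ℤ.∣m⇒∣m*n (U a b n) q∣b))
  ... | inj₁ q∣a = contradiction (a⊥b (∣ℤ⇒∣ q∣a , ∣ℤ⇒∣ q∣b)) (ℕ.>⇒≢ (prime≥2 pq))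
  ... | inj₂ q∣U′ = prime∣b⇒∤U pq q∣b n q∣U′

  prime∤consecutive : ∀ {q} → Prime q → ∀ n → + q ℤ.∣ U a b n → ¬ + q ℤ.∣ U a b (suc n)
  prime∤consecutive pq zero _ = prime∤1 pq
  prime∤consecutive pq (suc n) q∣Uₙ₊₁ q∣Uₙ₊₂
    with euclidsLemmaℤ b (U a b n) pq (ℤ.∣m+n∣m⇒∣n q∣Uₙ₊₂ (ℤ.∣n⇒∣m*n a q∣Uₙ₊₁))
  ... | inj₁ q∣b = prime∣b⇒∤U pq q∣b n q∣Uₙ₊₁
  ... | inj₂ q∣Uₙ = prime∤consecutive pq n q∣Uₙ q∣Uₙ₊₁

  private
    *-pres-∣ℤ : ∀ {m n x y} → + m ℤ.∣ x → + n ℤ.∣ y → + (m ℕ.* n) ℤ.∣ x * y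
    *-pres-∣ℤ {x = x} {y} m∣x n∣y = ∣⇒∣ℤ (subst (_ ∣_) (sym (abs-* x y)) (*-pres-∣ (∣ℤ⇒∣ m∣x) (∣ℤ⇒∣ n∣y)))

    prime∤^ : ∀ {q y} → Prime q → ¬ + q ℤ.∣ y → ∀ k → ¬ + q ℤ.∣ y ^ k
    prime∤^ pq q∤y zero = prime∤1 pq
    prime∤^ {y = y} pq q∤y (suc k) q∣yʸᵏ with euclidsLemmaℤ y (y ^ k) pq q∣yʸᵏ
    ... | inj₁ q∣y = q∤y q∣y
    ... | inj₂ q∣yᵏ = prime∤^ pq q∤y k q∣yᵏ

    prime∣u⇒∤Y : ∀ {q} e → Prime q → q ∣ u (suc e) → ¬ + q ℤ.∣ Block.Y e
    prime∣u⇒∤Y e pq q∣X q∣Y with euclidsLemmaℤ b (U a b e) pq q∣Y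
    ... | inj₁ q∣b = prime∣b⇒∤U pq q∣b e (∣⇒∣ℤ q∣X)
    ... | inj₂ q∣Uₑ = prime∤consecutive pq e q∣Uₑ (∣⇒∣ℤ q∣X)

  opaque
    -- ω d k = U (k d) / U d, with a junk value at d = 0. It is opaque so that instance
    -- search does not try to unfold NonZero (ω d k) into NonZero (u n).
    ω : ℕ → ℕ → ℕ
    ω zero k = 0
    ω (suc e) k = ∣ Block.ω e k ∣

    u-block : ∀ d k → u (k ℕ.* d) ≡ u d ℕ.* ω d k
    u-block zero k = cong u (ℕ.*-zeroʳ k)
    u-block (suc e) k = trans (cong ∣_∣ (Block.U-block e k)) (abs-* (U a b (suc e)) (Block.ω e k))

    ω-unfold : ∀ e k → ω (suc e) k ≡ ∣ Block.ω e k ∣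
    ω-unfold e k = refl

  -- Modulo U d, ω d k ≡ k Y^(k-1) with Y = b U (d - 1) prime to U d.
  ∣ω⇒∣ : ∀ {q d k} → Prime q → .{{NonZero d}} → .{{NonZero k}} → q ∣ u d → q ∣ ω d k → q ∣ k
  ∣ω⇒∣ {q} {suc e} {suc k} pq q∣X q∣ω with Block.ω-mod-X e k
  ... | r , ω≡ with euclidsLemmaℤ (+ suc k) (Block.Y e ^ k) pq q∣kYᵏ
    where
    q∣kYᵏ : + q ℤ.∣ + suc k * Block.Y e ^ k
    q∣kYᵏ = ℤ.∣m+n∣n⇒∣m (subst (+ q ℤ.∣_) ω≡ (∣⇒∣ℤ (subst (q ∣_) (ω-unfold e (suc k)) q∣ω)))
                        (ℤ.∣n⇒∣m*n r (∣⇒∣ℤ q∣X))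
  ...   | inj₁ q∣k = ∣ℤ⇒∣ q∣k
  ...   | inj₂ q∣Yᵏ = contradiction q∣Yᵏ (prime∤^ pq (prime∣u⇒∤Y e pq q∣X) k)

  ∣⇒∣ω : ∀ {q d k} → .{{NonZero d}} → q ∣ u d → q ∣ k → q ∣ ω d k
  ∣⇒∣ω {q} {suc e} {zero} _ _ = subst (q ∣_) (sym (ω-unfold e 0)) (q ∣0)
  ∣⇒∣ω {q} {suc e} {suc k} q∣X q∣k with Block.ω-mod-X e k
  ... | r , ω≡ = subst (q ∣_) (sym (ω-unfold e (suc k))) (∣ℤ⇒∣ (subst (+ q ℤ.∣_) (sym ω≡)
                   (ℤ.∣m∣n⇒∣m+n (ℤ.∣m⇒∣m*n {+ q} {+ suc k} (Block.Y e ^ k) (∣⇒∣ℤ q∣k))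
                                (ℤ.∣n⇒∣m*n {+ q} r {Block.X e} (∣⇒∣ℤ q∣X)))))

  -- Modulo (U d)², 2 Y ω d q ≡ 2 q Y^q + q (q - 1) a (U d) Y^(q-1), whose last term
  -- vanishes modulo q².
  q²∤ω : ∀ {q e} → Prime q → q ≢ 2 → q ∣ u (suc e) → ¬ q ℕ.* q ∣ ω (suc e) q
  q²∤ω {suc k} {e} pq q≢2 q∣X q²∣ω = [ q∤2 , prime∤^ pq (prime∣u⇒∤Y e pq q∣X) (suc k) ]′
                                          (euclidsLemmaℤ (+ 2) (Y ^ suc k) pq q∣2Yᵠ)
    where
    open Block e using (X; Y)
    q = suc k
    r = proj₁ (Block.ω-mod-X² e k)
    2Yω≡ = proj₂ (Block.ω-mod-X² e k)
    q∤2 : ¬ + q ℤ.∣ + 2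
    q∤2 q∣2 = q≢2 (ℕ.≤-antisym (∣⇒≤ (∣ℤ⇒∣ q∣2)) (prime≥2 pq))
    Q∣X : + q ℤ.∣ X
    Q∣X = ∣⇒∣ℤ q∣X
    Q² = + (q ℕ.* q)
    A B C : ℤ
    A = + 2 * + q * Y ^ q
    B = + q * + k * a * X * Y ^ k
    C = r * (X * X)
    Q²∣A+B+C : Q² ℤ.∣ A + B + C
    Q²∣A+B+C = subst (Q² ℤ.∣_) 2Yω≡ (ℤ.∣n⇒∣m*n {Q²} (+ 2 * Y) (∣⇒∣ℤ (subst (q ℕ.* q ∣_) (ω-unfold e q) q²∣ω)))
    Q²∣B : Q² ℤ.∣ B
    Q²∣B = subst (Q² ℤ.∣_) (sym (lemma (+ q) (+ k) a X (Y ^ k)))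
                  (ℤ.∣m⇒∣m*n {Q²} (+ k * a * Y ^ k) (*-pres-∣ℤ {q} {q} {+ q} {X} ℤ.∣-refl Q∣X))
      where
      lemma : ∀ q k a x yᵏ → q * k * a * x * yᵏ ≡ (q * x) * (k * a * yᵏ)
      lemma = solve-∀
    Q²∣C : Q² ℤ.∣ C
    Q²∣C = ℤ.∣n⇒∣m*n {Q²} r (*-pres-∣ℤ {q} {q} {X} {X} Q∣X Q∣X)
    q²∣2qYᵠ : Q² ℤ.∣ A
    q²∣2qYᵠ = ℤ.∣m+n∣n⇒∣m {Q²} {A} {B} (ℤ.∣m+n∣n⇒∣m {Q²} {A + B} {C} Q²∣A+B+C Q²∣C) Q²∣B
    q∣2Yᵠ : + q ℤ.∣ + 2 * Y ^ q
    q∣2Yᵠ = ℤ.*-cancelˡ-∣ (+ q) (subst (+ (q ℕ.* q) ℤ.∣_) (lemma (+ q) (Y ^ q)) q²∣2qYᵠ)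
      where
      lemma : ∀ q yᵠ → + 2 * q * yᵠ ≡ q * (+ 2 * yᵠ)
      lemma = solve-∀

  instance
    ω-nonZero : ∀ {d k} .{{_ : NonZero d}} .{{_ : NonZero k}} → NonZero (ω d k)
    ω-nonZero {d} {k} = ℕ.m*n≢0⇒n≢0 (u d) {{subst NonZero (u-block d k) (u-nonZero (k ℕ.* d) {{ℕ.m*n≢0 k d}})}}

  u∣u : ∀ {j s} → j ∣ s → u j ∣ u s
  u∣u {j} (divides k refl) = divides (ω j k) (trans (u-block j k) (ℕ.*-comm (u j) (ω j k)))

  ∣u-sub : ∀ {x} m n → x ∣ u (m ℕ.+ n) → x ∣ u n → x ∣ u m
  ∣u-sub m zero x∣u x∣u₀ = subst (λ i → _ ∣ u i) (ℕ.+-identityʳ m) x∣u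
  ∣u-sub m (suc zero) x∣u x∣u₁ = subst (_∣ u m) (sym (∣1⇒≡1 x∣u₁)) (1∣ u m)
  ∣u-sub {x} m (suc (suc n)) x∣u x∣uₙ₊₂ = coprime-divisor x⊥bu (subst (x ∣_) reorder x∣bUU)
    where
    x∣bUU : x ∣ ∣ b * U a b m * U a b (suc n) ∣
    x∣bUU = ∣ℤ⇒∣ (ℤ.∣m+n∣m⇒∣n (subst (+ x ℤ.∣_) (U-+ m (suc n)) (∣⇒∣ℤ x∣u))
                              (ℤ.∣n⇒∣m*n (U a b (suc m)) (∣⇒∣ℤ x∣uₙ₊₂)))
    reorder : ∣ b * U a b m * U a b (suc n) ∣ ≡ ∣ b ∣ ℕ.* u (suc n) ℕ.* u m
    reorder = trans (abs-* (b * U a b m) (U a b (suc n)))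
              (trans (cong (ℕ._* u (suc n)) (abs-* b (U a b m))) (lemma ∣ b ∣ (u m) (u (suc n))))
      where
      lemma : ∀ x y z → x ℕ.* y ℕ.* z ≡ x ℕ.* z ℕ.* y
      lemma = ℕ-Solver.solve-∀
    x⊥bu : Coprime x (∣ b ∣ ℕ.* u (suc n))
    x⊥bu = coprime-by-primes λ q pq q∣x q∣bu → case euclidsLemma ∣ b ∣ (u (suc n)) pq q∣bu of λ where
      (inj₁ q∣b) → prime∣b⇒∤U pq (∣⇒∣ℤ q∣b) (suc n) (∣⇒∣ℤ (∣-trans q∣x x∣uₙ₊₂))
      (inj₂ q∣u) → prime∤consecutive pq (suc n) (∣⇒∣ℤ q∣u) (∣⇒∣ℤ (∣-trans q∣x x∣uₙ₊₂))

  ∣u-gcd : ∀ {x} m n → x ∣ u m → x ∣ u n → x ∣ u (gcd m n)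
  ∣u-gcd {x} m n x∣uₘ x∣uₙ with Bézout.identity (gcd-GCD m n)
  ... | Bézout.+- i j eq = ∣u-sub (gcd m n) (j ℕ.* n) (subst (λ t → x ∣ u t) (sym eq) (∣-trans x∣uₘ (u∣u (n∣m*n i))))
                                                    (∣-trans x∣uₙ (u∣u (n∣m*n j)))
  ... | Bézout.-+ i j eq = ∣u-sub (gcd m n) (i ℕ.* m) (subst (λ t → x ∣ u t) (sym eq) (∣-trans x∣uₙ (u∣u (n∣m*n j))))
                                                    (∣-trans x∣uₘ (u∣u (n∣m*n i)))

  coprime-u : ∀ {m n} → Coprime m n → Coprime (u m) (u n)
  coprime-u {m} {n} m⊥n (d∣uₘ , d∣uₙ) = ∣1⇒≡1 (subst (λ i → _ ∣ u i) (coprime⇒gcd≡1 m⊥n) (∣u-gcd m n d∣uₘ d∣uₙ))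

  rank-∣ : ∀ {x j} → .{{NonZero j}} → x ∣ u j → (∀ t → .{{NonZero t}} → t ℕ.< j → ¬ x ∣ u t) →
           ∀ s → x ∣ u s → j ∣ s
  rank-∣ {x} {j} x∣uⱼ minimal s x∣uₛ = by-remainder (s % j) (s / j) (m≡m%n+[m/n]*n s j) (m%n<n s j)
    where
    by-remainder : ∀ r k → s ≡ r ℕ.+ k ℕ.* j → r ℕ.< j → j ∣ s
    by-remainder zero k s≡ _ = divides k s≡
    by-remainder r@(suc _) k s≡ r<j = contradiction
      (∣u-sub r (k ℕ.* j) (subst (λ i → x ∣ u i) s≡ x∣uₛ) (∣-trans x∣uⱼ (u∣u (n∣m*n k))))
      (minimal r r<j)

  u∣u⇒∣ : ∀ {j s} → j ≢ 2 → u j ∣ u s → j ∣ s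
  u∣u⇒∣ {zero} {zero} _ _ = ∣-refl
  u∣u⇒∣ {zero} {s@(suc _)} _ u₀∣uₛ = contradiction (0∣⇒≡0 u₀∣uₛ) (ℕ.≢-nonZero⁻¹ (u s) {{u-nonZero s}})
  u∣u⇒∣ {1} {s} _ _ = 1∣ s
  u∣u⇒∣ {2} j≢2 _ = contradiction refl j≢2
  u∣u⇒∣ {j@(suc (suc (suc _)))} {s} _ uⱼ∣uₛ = rank-∣ ∣-refl too-small s uⱼ∣uₛ
    where
    too-small : ∀ t → .{{NonZero t}} → t ℕ.< j → ¬ u j ∣ u t
    too-small t t<j uⱼ∣uₜ =
      ℕ.<⇒≱ (u-<-mono (ℕ.>-nonZero⁻¹ t) t<j (s≤s (s≤s (s≤s z≤n)))) (∣⇒≤ {{u-nonZero t}} uⱼ∣uₜ)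

  ω-* : ∀ d j k → .{{NonZero d}} → ω d (j ℕ.* k) ≡ ω d j ℕ.* ω (j ℕ.* d) k
  ω-* d j k = ℕ.*-cancelˡ-≡ _ _ (u d) {{u-nonZero d}} (begin
    u d ℕ.* ω d (j ℕ.* k)                ≡⟨ u-block d (j ℕ.* k) ⟨
    u (j ℕ.* k ℕ.* d)                    ≡⟨ cong u (lemma j k d) ⟩
    u (k ℕ.* (j ℕ.* d))                  ≡⟨ u-block (j ℕ.* d) k ⟩
    u (j ℕ.* d) ℕ.* ω (j ℕ.* d) k        ≡⟨ cong (ℕ._* ω (j ℕ.* d) k) (u-block d j) ⟩
    u d ℕ.* ω d j ℕ.* ω (j ℕ.* d) k      ≡⟨ ℕ.*-assoc (u d) _ _ ⟩
    u d ℕ.* (ω d j ℕ.* ω (j ℕ.* d) k)    ∎)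
    where
    open ≡-Reasoning
    lemma : ∀ j k d → j ℕ.* k ℕ.* d ≡ k ℕ.* (j ℕ.* d)
    lemma = ℕ-Solver.solve-∀

  ω-2 : ∀ d → .{{NonZero d}} → ω d 2 ≡ v d
  ω-2 d = ℕ.*-cancelˡ-≡ _ _ (u d) {{u-nonZero d}} (begin
    u d ℕ.* ω d 2      ≡⟨ u-block d 2 ⟨
    u (2 ℕ.* d)        ≡⟨ cong u (cong (d ℕ.+_) (ℕ.+-identityʳ d)) ⟩
    u (d ℕ.+ d)        ≡⟨ cong ∣_∣ (U-double d) ⟩
    ∣ U a b d * V a b d ∣ ≡⟨ abs-* (U a b d) (V a b d) ⟩
    u d ℕ.* v d        ∎)
    where open ≡-Reasoning

  ω-∣ : ∀ {d x y} → .{{NonZero d}} → x ∣ y → ω d x ∣ ω d y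
  ω-∣ {d} {x} {y} x∣y = *-cancelˡ-∣ (u d) {{u-nonZero d}} (subst₂ _∣_ (u-block d x) (u-block d y) (u∣u (*-monoˡ-∣ d x∣y)))

  coprime-ω : ∀ {d x y} → .{{NonZero d}} → Coprime x y → Coprime (ω d x) (ω d y)
  coprime-ω {d} {x} {y} x⊥y {c} (c∣ωx , c∣ωy) =
    ∣1⇒≡1 (*-cancelˡ-∣ (u d) {{u-nonZero d}} (subst (u d ℕ.* c ∣_) (sym (ℕ.*-identityʳ (u d))) uᵈc∣uᵈ))
    where
    uᵈc∣u : ∀ {z} → c ∣ ω d z → u d ℕ.* c ∣ u (z ℕ.* d)
    uᵈc∣u {z} c∣ωz = subst (u d ℕ.* c ∣_) (sym (u-block d z)) (*-monoʳ-∣ (u d) c∣ωz)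
    gcd≡d : gcd (x ℕ.* d) (y ℕ.* d) ≡ d
    gcd≡d = trans (cong₂ gcd (ℕ.*-comm x d) (ℕ.*-comm y d))
            (trans (sym (c*gcd[m,n]≡gcd[cm,cn] d x y)) (trans (cong (d ℕ.*_) (coprime⇒gcd≡1 x⊥y)) (ℕ.*-identityʳ d)))
    uᵈc∣uᵈ : u d ℕ.* c ∣ u d
    uᵈc∣uᵈ = subst (λ i → u d ℕ.* c ∣ u i) gcd≡d (∣u-gcd (x ℕ.* d) (y ℕ.* d) (uᵈc∣u c∣ωx) (uᵈc∣u c∣ωy))

  ν-ω-prime : ∀ {q d} → Prime q → q ≢ 2 → .{{NonZero d}} → q ∣ u d → ν q (ω d q) ≡ 1
  ν-ω-prime {q} {d@(suc _)} pq q≢2 q∣uᵈ = ℕ.≤-antisym ν≤1 (∣⇒ν≥1 (prime≥2 pq) (∣⇒∣ω q∣uᵈ ∣-refl))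
    where
    instance
      q≢0 : NonZero q
      q≢0 = prime⇒nonZero pq
    ν≤1 : ν q (ω d q) ℕ.≤ 1
    ν≤1 with ν q (ω d q) ℕ.≤? 1
    ... | yes ν≤1 = ν≤1
    ... | no ν≰1 = contradiction (subst (_∣ ω d q) (cong (q ℕ.*_) (ℕ.*-identityʳ q)) (≤ν⇒^∣ (prime≥2 pq) (ℕ.≰⇒> ν≰1)))
                                (q²∤ω pq q≢2 q∣uᵈ)

  -- For even d, V d = (V (d/2))² - 2 (-b)^(d/2) with V (d/2) even and b odd.
  ν₂-v-double : ∀ f → .{{NonZero f}} → 2 ∣ u (f ℕ.+ f) → ν 2 (v (f ℕ.+ f)) ≡ 1
  ν₂-v-double f@(suc _) 2∣u₂f = ℕ.≤-antisym ν≤1 (∣⇒ν≥1 ℕ.≤-refl {{v-nonZero (f ℕ.+ f)}} (∣ℤ⇒∣ 2∣V₂f))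
    where
    2∣Vf : + 2 ℤ.∣ V a b f
    2∣Vf with euclidsLemma (u f) (v f) prime[2] (subst (2 ∣_) (trans (cong ∣_∣ (U-double f)) (abs-* (U a b f) (V a b f))) 2∣u₂f)
    ... | inj₁ 2∣uf = subst (+ 2 ℤ.∣_) (sym (V≡2U-aU f))
                        (ℤ.∣m∣n⇒∣m-n (ℤ.∣m⇒∣m*n (U a b (suc f)) (ℤ.∣-refl {+ 2})) (ℤ.∣n⇒∣m*n a (∣⇒∣ℤ 2∣uf)))
    ... | inj₂ 2∣vf = ∣⇒∣ℤ 2∣vf
    2∣2bᶠ : + 2 ℤ.∣ + 2 * (- b) ^ f
    2∣2bᶠ = ℤ.∣m⇒∣m*n ((- b) ^ f) (ℤ.∣-refl {+ 2})
    2∣V₂f : + 2 ℤ.∣ V a b (f ℕ.+ f)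
    2∣V₂f = subst (+ 2 ℤ.∣_) (sym (V-double f)) (ℤ.∣m∣n⇒∣m-n (ℤ.∣m⇒∣m*n (V a b f) 2∣Vf) 2∣2bᶠ)
    4∤V₂f : ¬ 4 ∣ v (f ℕ.+ f)
    4∤V₂f 4∣v = prime∤^ prime[2] 2∤-b f (ℤ.*-cancelˡ-∣ (+ 2) 4∣2bᶠ)
      where
      4∣2bᶠ : + 4 ℤ.∣ + 2 * (- b) ^ f
      4∣2bᶠ = subst (+ 4 ℤ.∣_) (lemma (V a b f * V a b f) (+ 2 * (- b) ^ f))
                (ℤ.∣m∣n⇒∣m-n {+ 4} (*-pres-∣ℤ {2} {2} 2∣Vf 2∣Vf) (subst (+ 4 ℤ.∣_) (V-double f) (∣⇒∣ℤ 4∣v)))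
        where
        lemma : ∀ x y → x - (x - y) ≡ y
        lemma = solve-∀
      2∤-b : ¬ + 2 ℤ.∣ - b
      2∤-b 2∣-b = prime∣b⇒∤U prime[2] (∣⇒∣ℤ (subst (2 ∣_) (∣-i∣≡∣i∣ b) (∣ℤ⇒∣ 2∣-b)))
                             (ℕ.pred (f ℕ.+ f)) (∣⇒∣ℤ 2∣u₂f)
    ν≤1 : ν 2 (v (f ℕ.+ f)) ℕ.≤ 1
    ν≤1 with ν 2 (v (f ℕ.+ f)) ℕ.≤? 1
    ... | yes ν≤1 = ν≤1
    ... | no ν≰1 = contradiction (≤ν⇒^∣ ℕ.≤-refl {{v-nonZero (f ℕ.+ f)}} (ℕ.≰⇒> ν≰1)) 4∤V₂f

  ν-ω-∤ : ∀ {q d k} → Prime q → .{{NonZero d}} → .{{NonZero k}} → q ∣ u d → ¬ q ∣ k → ν q (ω d k) ≡ 0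
  ν-ω-∤ pq q∣uᵈ q∤k = ν-∤ (prime≥2 pq) (λ q∣ω → q∤k (∣ω⇒∣ pq q∣uᵈ q∣ω))

  private
    ν-ω-step : ∀ {q d} → Prime q → .{{NonZero d}} → q ∣ u d → q ≢ 2 ⊎ 2 ∣ d → ν q (ω d q) ≡ 1
    ν-ω-step pq q∣uᵈ (inj₁ q≢2) = ν-ω-prime pq q≢2 q∣uᵈ
    ν-ω-step {q} {d} pq q∣uᵈ (inj₂ 2∣d) with q ℕ.≟ 2
    ... | no q≢2 = ν-ω-prime pq q≢2 q∣uᵈ
    ... | yes refl with 2∣d
    ...   | divides f@(suc _) refl =
      trans (cong (ν 2) (trans (ω-2 d) (cong v f*2≡f+f))) (ν₂-v-double f (subst (λ i → 2 ∣ u i) f*2≡f+f q∣uᵈ))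
      where
      f*2≡f+f : f ℕ.* 2 ≡ f ℕ.+ f
      f*2≡f+f = trans (ℕ.*-comm f 2) (cong (f ℕ.+_) (ℕ.+-identityʳ f))

    ν-ω-q^e* : ∀ {q} → Prime q → ∀ e r → .{{NonZero r}} → ¬ q ∣ r →
                ∀ d → .{{NonZero d}} → q ∣ u d → q ≢ 2 ⊎ 2 ∣ d → ν q (ω d (q ℕ.^ e ℕ.* r)) ≡ e
    ν-ω-q^e* {q} pq zero r q∤r d q∣uᵈ _ =
      ν-ω-∤ pq {{it}} {{subst NonZero (sym (ℕ.*-identityˡ r)) it}} q∣uᵈ (subst (λ x → ¬ q ∣ x) (sym (ℕ.*-identityˡ r)) q∤r)
    ν-ω-q^e* {q} pq (suc e) r q∤r d q∣uᵈ parity = begin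
      ν q (ω d (q ℕ.* q ℕ.^ e ℕ.* r))              ≡⟨ cong (λ k → ν q (ω d k)) (ℕ.*-assoc q (q ℕ.^ e) r) ⟩
      ν q (ω d (q ℕ.* (q ℕ.^ e ℕ.* r)))            ≡⟨ cong (ν q) (ω-* d q (q ℕ.^ e ℕ.* r)) ⟩
      ν q (ω d q ℕ.* ω (q ℕ.* d) (q ℕ.^ e ℕ.* r))  ≡⟨ ν-* pq (ω d q) (ω (q ℕ.* d) (q ℕ.^ e ℕ.* r)) ⟩
      ν q (ω d q) ℕ.+ ν q (ω (q ℕ.* d) (q ℕ.^ e ℕ.* r))
        ≡⟨ cong₂ ℕ._+_ (ν-ω-step pq q∣uᵈ parity)
                       (ν-ω-q^e* pq e r q∤r (q ℕ.* d) (∣-trans q∣uᵈ (u∣u (n∣m*n q))) parity′) ⟩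
      suc e ∎
      where
      open ≡-Reasoning
      instance
        q≢0 : NonZero q
        q≢0 = prime⇒nonZero pq
        qᵉr≢0 : NonZero (q ℕ.^ e ℕ.* r)
        qᵉr≢0 = ℕ.m*n≢0 (q ℕ.^ e) r {{ℕ.m^n≢0 q e}}
        qd≢0 : NonZero (q ℕ.* d)
        qd≢0 = ℕ.m*n≢0 q d
      parity′ : q ≢ 2 ⊎ 2 ∣ q ℕ.* d
      parity′ = map₂ (∣n⇒∣m*n q) parity

  ν-ω≡ν : ∀ {q d} → Prime q → .{{NonZero d}} → q ∣ u d → q ≢ 2 ⊎ 2 ∣ d →
          ∀ k → .{{NonZero k}} → ν q (ω d k) ≡ ν q k
  ν-ω≡ν {q} {d} pq q∣uᵈ parity k with ν-exact {q} k (prime≥2 pq)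
  ... | exact r k≡ q∤r = trans (cong (λ i → ν q (ω d i)) k≡) (ν-ω-q^e* pq (ν q k) r {{r≢0}} q∤r d q∣uᵈ parity)
    where
    r≢0 : NonZero r
    r≢0 = ℕ.m*n≢0⇒n≢0 (q ℕ.^ ν q k) {{subst NonZero k≡ it}}

  ν₂-ω-2* : ∀ {d} → .{{NonZero d}} → 2 ∣ u d → ∀ k → .{{NonZero k}} → ν 2 (ω d (2 ℕ.* k)) ≡ ν 2 (v d) ℕ.+ ν 2 k
  ν₂-ω-2* {d} 2∣uᵈ k = begin
    ν 2 (ω d (2 ℕ.* k))                    ≡⟨ cong (ν 2) (ω-* d 2 k) ⟩
    ν 2 (ω d 2 ℕ.* ω (2 ℕ.* d) k)          ≡⟨ ν-* prime[2] (ω d 2) (ω (2 ℕ.* d) k) ⟩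
    ν 2 (ω d 2) ℕ.+ ν 2 (ω (2 ℕ.* d) k)
      ≡⟨ cong₂ ℕ._+_ (cong (ν 2) (ω-2 d)) (ν-ω≡ν prime[2] 2∣u₂d (inj₂ (m∣m*n d)) k) ⟩
    ν 2 (v d) ℕ.+ ν 2 k                    ∎
    where
    open ≡-Reasoning
    instance
      2d≢0 : NonZero (2 ℕ.* d)
      2d≢0 = ℕ.m*n≢0 2 d
    2∣u₂d : 2 ∣ u (2 ℕ.* d)
    2∣u₂d = ∣-trans 2∣uᵈ (u∣u {d} (n∣m*n 2))

  prime∣u∧v⇒≡2 : ∀ {q n} → Prime q → q ∣ u n → q ∣ v n → q ≡ 2
  prime∣u∧v⇒≡2 {q} {n} pq q∣uₙ q∣vₙ with euclidsLemmaℤ (+ 2) (U a b (suc n)) pq q∣2Uₙ₊₁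
    where
    q∣2Uₙ₊₁ : + q ℤ.∣ + 2 * U a b (suc n)
    q∣2Uₙ₊₁ = subst (+ q ℤ.∣_) (trans (cong (_+ a * U a b n) (V≡2U-aU n)) (lemma (+ 2 * U a b (suc n)) (a * U a b n)))
                    (ℤ.∣m∣n⇒∣m+n (∣⇒∣ℤ {z = V a b n} q∣vₙ) (ℤ.∣n⇒∣m*n a (∣⇒∣ℤ {z = U a b n} q∣uₙ)))
      where
      lemma : ∀ x y → x - y + y ≡ x
      lemma = solve-∀
  ... | inj₁ q∣2 = ℕ.≤-antisym (∣⇒≤ (∣ℤ⇒∣ q∣2)) (prime≥2 pq)
  ... | inj₂ q∣Uₙ₊₁ = contradiction q∣Uₙ₊₁ (prime∤consecutive pq n (∣⇒∣ℤ {z = U a b n} q∣uₙ))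


module RankOfProducts (a b : ℤ.ℤ) (a⊥b : ℤ.Coprime a b) (b≢0 : b ≢ ℤ.+ 0) (a>0 : a ℤ.> ℤ.+ 0)
                      (Δ>0 : a ℤ.* a ℤ.+ ℤ.+ 4 ℤ.* b ℤ.> ℤ.+ 0) where

  open import Data.Nat.Base
  open import Data.Nat.Properties
  open import Data.Nat.Divisibility
  open import Data.Nat.Primality using (Prime; prime[2]; prime⇒nonZero; euclidsLemma)
  open import Data.Nat.Coprimality using (Coprime; coprime-divisor)
  open import Data.Nat.GCD using (gcd; gcd[m,n]∣m; gcd[m,n]∣n; gcd-greatest; c*gcd[m,n]≡gcd[cm,cn])
  open import Data.Nat.LCM using (lcm; lcm-least; gcd*lcm; m∣lcm[m,n]; n∣lcm[m,n])
  import Data.Nat.Coprimality as Coprime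
  open import Data.Product.Base using (_,_)
  open import Data.Sum.Base using (inj₁; inj₂)
  open import Relation.Nullary using (¬_; yes; no)
  open import Relation.Nullary.Negation using (contradiction)
  open import Function.Base using (it; case_of_)
  open import Relation.Binary.PropositionalEquality
  import Data.Nat.Tactic.RingSolver as ℕ-Solver
  open Arithmetic
  open Valuation
  open Coprimality
  open LucasSequence a b a⊥b b≢0 a>0 Δ>0

  record Rank (K T : ℕ) : Set where
    field
      T≢0 : NonZero T
      K∣uT : K ∣ u T
      least : ∀ s → .{{NonZero s}} → K ∣ u s → T ∣ s

  rank-coprime : ∀ {x y z} → .{{NonZero x}} → .{{NonZero y}} → .{{NonZero z}} → x ≢ 2 → y ≢ 2 → z ≢ 2 →
                 Coprime x y → Coprime x z → Coprime y z → Rank (u x * u y * u z) (x * y * z)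
  rank-coprime {x} {y} {z} x≢2 y≢2 z≢2 x⊥y x⊥z y⊥z = record
    { T≢0 = m*n≢0 (x * y) z {{m*n≢0 x y}}
    ; K∣uT = coprime-*-*-∣ (coprime-u x⊥y) (coprime-u x⊥z) (coprime-u y⊥z)
               (u∣u (m∣m*n*o x y z)) (u∣u (n∣m*n*o x z)) (u∣u (n∣m*n (x * y)))
    ; least = λ s K∣uₛ → coprime-*-*-∣ x⊥y x⊥z y⊥z
               (u∣u⇒∣ x≢2 (∣-trans (m∣m*n*o (u x) (u y) (u z)) K∣uₛ))
               (u∣u⇒∣ y≢2 (∣-trans (n∣m*n*o (u x) (u z)) K∣uₛ))
               (u∣u⇒∣ z≢2 (∣-trans (n∣m*n (u x * u y)) K∣uₛ))
    }

  module OddMultiple (m p : ℕ) .{{_ : NonZero m}} (pp : Prime p) (p≥3 : 3 ≤ p) (m-odd : ¬ 2 ∣ m) where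

    m₁ m₂ M P S : ℕ
    m₁ = suc m
    m₂ = suc (suc m)
    M = m * m₁ * m₂
    P = u p
    S = ω p m * ω p m₁ * ω p m₂

    instance
      p≢0 : NonZero p
      p≢0 = prime⇒nonZero pp
      P≢0 : NonZero P
      P≢0 = u-nonZero p
      M≢0 : NonZero M
      M≢0 = m*n≢0 (m * m₁) m₂ {{m*n≢0 m m₁}}
      S≢0 : NonZero S
      S≢0 = m*n≢0 (ω p m * ω p m₁) (ω p m₂) {{m*n≢0 (ω p m) (ω p m₁)}}
      PP≢0 : NonZero (P * P)
      PP≢0 = m*n≢0 P P

    m⊥m₁ : Coprime m m₁
    m⊥m₁ = coprime-suc m
    m₁⊥m₂ : Coprime m₁ m₂
    m₁⊥m₂ = coprime-suc m₁
    m⊥m₂ : Coprime m m₂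
    m⊥m₂ = coprime-by-primes λ q pq q∣m q∣m₂ →
      m-odd (subst (_∣ m) (prime∣prime⇒≡ pq prime[2] (∣m+n∣m⇒∣n (subst (q ∣_) (+-comm 2 m) q∣m₂) q∣m)) q∣m)

    S∣ω : ∀ X → S ∣ ω p (M * X)
    S∣ω X = coprime-*-*-∣ (coprime-ω m⊥m₁) (coprime-ω m⊥m₂) (coprime-ω m₁⊥m₂)
              (ω-∣ (∣-trans (m∣m*n*o m m₁ m₂) (m∣m*n X))) (ω-∣ (∣-trans (n∣m*n*o m m₂) (m∣m*n X)))
              (ω-∣ (∣-trans (n∣m*n (m * m₁)) (m∣m*n X)))

    ν-S-odd : ∀ {q} → Prime q → q ≢ 2 → q ∣ P → ∀ X → .{{NonZero X}} → ν q S + ν q X ≡ ν q (ω p (M * X))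
    ν-S-odd {q} pq q≢2 q∣P X = begin
      ν q S + ν q X                                      ≡⟨ cong (_+ ν q X) (ν-*-* pq (ω p m) (ω p m₁) (ω p m₂)) ⟩
      ν q (ω p m) + ν q (ω p m₁) + ν q (ω p m₂) + ν q X
        ≡⟨ cong (_+ ν q X) (cong₂ _+_ (cong₂ _+_ (ν-ω≡ν′ m) (ν-ω≡ν′ m₁)) (ν-ω≡ν′ m₂)) ⟩
      ν q m + ν q m₁ + ν q m₂ + ν q X                    ≡⟨ cong (_+ ν q X) (ν-*-* pq m m₁ m₂) ⟨
      ν q M + ν q X                                      ≡⟨ ν-* pq M X ⟨
      ν q (M * X)                                        ≡⟨ ν-ω≡ν′ (M * X) {{m*n≢0 M X}} ⟨
      ν q (ω p (M * X))                                  ∎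
      where
      open ≡-Reasoning
      ν-ω≡ν′ : ∀ k → .{{NonZero k}} → ν q (ω p k) ≡ ν q k
      ν-ω≡ν′ = ν-ω≡ν pq q∣P (inj₁ q≢2)

    -- The factor 2 of m + 1 contributes ν₂ (V p) once on each side.
    ν₂-S : 2 ∣ P → ∀ X → .{{NonZero X}} → ν 2 S + ν 2 X ≡ ν 2 (ω p (M * X))
    ν₂-S 2∣P X = begin
      ν 2 S + ν 2 X                                          ≡⟨ cong (_+ ν 2 X) (ν-*-* prime[2] (ω p m) (ω p m₁) (ω p m₂)) ⟩
      ν 2 (ω p m) + ν 2 (ω p m₁) + ν 2 (ω p m₂) + ν 2 X
        ≡⟨ cong (λ i → ν 2 (ω p m) + ν 2 (ω p i) + ν 2 (ω p m₂) + ν 2 X) m₁≡2h ⟩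
      ν 2 (ω p m) + ν 2 (ω p (2 * h)) + ν 2 (ω p m₂) + ν 2 X
        ≡⟨ cong₂ (λ i j → i + ν 2 (ω p (2 * h)) + j + ν 2 X) (ν-ω-∤ prime[2] 2∣P m-odd) (ν-ω-∤ prime[2] 2∣P m₂-odd) ⟩
      0 + ν 2 (ω p (2 * h)) + 0 + ν 2 X                      ≡⟨ cong (λ i → 0 + i + 0 + ν 2 X) (ν₂-ω-2* 2∣P h) ⟩
      0 + (ν 2 (v p) + ν 2 h) + 0 + ν 2 X                    ≡⟨ lemma (ν 2 (v p)) (ν 2 h) (ν 2 X) ⟩
      ν 2 (v p) + (0 + ν 2 h + 0 + ν 2 X)
        ≡⟨ cong₂ (λ i j → ν 2 (v p) + (i + ν 2 h + j + ν 2 X)) (ν-∤ ≤-refl m-odd) (ν-∤ ≤-refl m₂-odd) ⟨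
      ν 2 (v p) + (ν 2 m + ν 2 h + ν 2 m₂ + ν 2 X)
        ≡⟨ cong (ν 2 (v p) +_) (trans (ν-* prime[2] (m * h * m₂) X) (cong (_+ ν 2 X) (ν-*-* prime[2] m h m₂))) ⟨
      ν 2 (v p) + ν 2 (m * h * m₂ * X)                       ≡⟨ ν₂-ω-2* 2∣P (m * h * m₂ * X) ⟨
      ν 2 (ω p (2 * (m * h * m₂ * X)))                       ≡⟨ cong (λ i → ν 2 (ω p i)) MX≡ ⟨
      ν 2 (ω p (M * X))                                      ∎
      where
      open ≡-Reasoning
      2∣m₁ : 2 ∣ m₁
      2∣m₁ = ¬2∣⇒2∣suc m m-odd
      h = quotient 2∣m₁
      m₁≡2h : m₁ ≡ 2 * h
      m₁≡2h = m∣n⇒n≡m*quotient 2∣m₁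
      instance
        h≢0 : NonZero h
        h≢0 = quotient≢0 2∣m₁
        mhm₂≢0 : NonZero (m * h * m₂)
        mhm₂≢0 = m*n≢0 (m * h) m₂ {{m*n≢0 m h}}
        mhm₂X≢0 : NonZero (m * h * m₂ * X)
        mhm₂X≢0 = m*n≢0 (m * h * m₂) X
      m₂-odd : ¬ 2 ∣ m₂
      m₂-odd 2∣m₂ = m-odd (∣m+n∣m⇒∣n 2∣m₂ (∣-refl {2}))
      MX≡ : M * X ≡ 2 * (m * h * m₂ * X)
      MX≡ = trans (cong (λ i → m * i * m₂ * X) m₁≡2h) (lemma′ m h m₂ X)
        where
        lemma′ : ∀ m h m₂ x → m * (2 * h) * m₂ * x ≡ 2 * (m * h * m₂ * x)
        lemma′ = ℕ-Solver.solve-∀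
      lemma : ∀ v h x → 0 + (v + h) + 0 + x ≡ v + (0 + h + 0 + x)
      lemma = ℕ-Solver.solve-∀

    ν-S : ∀ {q} → Prime q → q ∣ P → ∀ X → .{{NonZero X}} → ν q S + ν q X ≡ ν q (ω p (M * X))
    ν-S {q} pq q∣P X with q ≟ 2
    ... | no q≢2 = ν-S-odd pq q≢2 q∣P X
    ... | yes refl = ν₂-S q∣P X

    private
      ν-PP≡0 : ∀ {q} → Prime q → ¬ q ∣ P → ν q (P * P) ≡ 0
      ν-PP≡0 pq q∤P = ν-∤ (prime≥2 pq) λ q∣PP → case euclidsLemma P P pq q∣PP of λ where
        (inj₁ q∣P) → q∤P q∣P
        (inj₂ q∣P) → q∤P q∣P

    PPS∣ω⇒PP∣ : ∀ X → .{{NonZero X}} → P * P * S ∣ ω p (M * X) → P * P ∣ X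
    PPS∣ω⇒PP∣ X PPS∣ω = ∣-by-ν ν≤
      where
      open ≤-Reasoning
      instance
        MX≢0 : NonZero (M * X)
        MX≢0 = m*n≢0 M X
      ν≤ : ∀ q → Prime q → ν q (P * P) ≤ ν q X
      ν≤ q pq with q ∣? P
      ... | no q∤P = subst (_≤ ν q X) (sym (ν-PP≡0 pq q∤P)) z≤n
      ... | yes q∣P = +-cancelˡ-≤ (ν q S) _ _ (begin
        ν q S + ν q (P * P)     ≡⟨ +-comm (ν q S) _ ⟩
        ν q (P * P) + ν q S     ≡⟨ ν-* pq (P * P) S ⟨
        ν q (P * P * S)         ≤⟨ ν-mono pq PPS∣ω ⟩
        ν q (ω p (M * X))       ≡⟨ ν-S pq q∣P X ⟨
        ν q S + ν q X           ∎)

    PP∣⇒PPS∣ω : ∀ X → .{{NonZero X}} → P * P ∣ X → P * P * S ∣ ω p (M * X)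
    PP∣⇒PPS∣ω X PP∣X = ∣-by-ν {{m*n≢0 (P * P) S}} ν≤
      where
      open ≤-Reasoning
      instance
        MX≢0 : NonZero (M * X)
        MX≢0 = m*n≢0 M X
      ν≤ : ∀ q → Prime q → ν q (P * P * S) ≤ ν q (ω p (M * X))
      ν≤ q pq with q ∣? P
      ... | yes q∣P = begin
        ν q (P * P * S)         ≡⟨ ν-* pq (P * P) S ⟩
        ν q (P * P) + ν q S     ≤⟨ +-monoˡ-≤ (ν q S) (ν-mono pq PP∣X) ⟩
        ν q X + ν q S           ≡⟨ +-comm (ν q X) (ν q S) ⟩
        ν q S + ν q X           ≡⟨ ν-S pq q∣P X ⟩
        ν q (ω p (M * X))       ∎
      ... | no q∤P = begin
        ν q (P * P * S)         ≡⟨ ν-* pq (P * P) S ⟩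
        ν q (P * P) + ν q S     ≡⟨ cong (_+ ν q S) (ν-PP≡0 pq q∤P) ⟩
        ν q S                   ≤⟨ ν-mono pq (S∣ω X) ⟩
        ν q (ω p (M * X))       ∎

    K : ℕ
    K = u (m * p) * u (m₁ * p) * u (m₂ * p)

    K≡ : K ≡ P * (P * P * S)
    K≡ = trans (cong₂ (λ x y → x * y * u (m₂ * p)) (u-block p m) (u-block p m₁))
         (trans (cong (P * ω p m * (P * ω p m₁) *_) (u-block p m₂)) (lemma P (ω p m) (ω p m₁) (ω p m₂)))
      where
      lemma : ∀ P x y z → P * x * (P * y) * (P * z) ≡ P * (P * P * (x * y * z))
      lemma = ℕ-Solver.solve-∀

    *p≢2 : ∀ x → .{{NonZero x}} → x * p ≢ 2
    *p≢2 x = ≥3⇒≢2 (≤-trans p≥3 (m≤n*m p x))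

    K∣u⇒∣ : ∀ s → .{{NonZero s}} → K ∣ u s → M * (P * P) * p ∣ s
    K∣u⇒∣ s K∣uₛ = subst (M * (P * P) * p ∣_) (sym s≡MXp) (*-monoˡ-∣ p (*-monoʳ-∣ M PP∣X))
      where
      mp∣s : m * p ∣ s
      mp∣s = u∣u⇒∣ (*p≢2 m) (∣-trans (m∣m*n*o (u (m * p)) _ _) K∣uₛ)
      m₁p∣s : m₁ * p ∣ s
      m₁p∣s = u∣u⇒∣ (*p≢2 m₁) (∣-trans (n∣m*n*o (u (m * p)) _) K∣uₛ)
      m₂p∣s : m₂ * p ∣ s
      m₂p∣s = u∣u⇒∣ (*p≢2 m₂) (∣-trans (n∣m*n (u (m * p) * u (m₁ * p))) K∣uₛ)
      p∣s : p ∣ s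
      p∣s = ∣-trans (n∣m*n m) mp∣s
      s₁ = quotient p∣s
      s≡s₁p : s ≡ s₁ * p
      s≡s₁p = m∣n⇒n≡quotient*m p∣s
      instance
        s₁≢0 : NonZero s₁
        s₁≢0 = quotient≢0 p∣s
      ∣s₁ : ∀ {x} → x * p ∣ s → x ∣ s₁
      ∣s₁ {x} xp∣s = *-cancelʳ-∣ p (subst (x * p ∣_) s≡s₁p xp∣s)
      M∣s₁ : M ∣ s₁
      M∣s₁ = coprime-*-*-∣ m⊥m₁ m⊥m₂ m₁⊥m₂ (∣s₁ mp∣s) (∣s₁ m₁p∣s) (∣s₁ m₂p∣s)
      X = quotient M∣s₁
      s≡MXp : s ≡ M * X * p
      s≡MXp = trans s≡s₁p (cong (_* p) (m∣n⇒n≡m*quotient M∣s₁))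
      instance
        X≢0 : NonZero X
        X≢0 = quotient≢0 M∣s₁
      PP∣X : P * P ∣ X
      PP∣X = PPS∣ω⇒PP∣ X (*-cancelˡ-∣ P (subst₂ _∣_ K≡ (trans (cong u s≡MXp) (u-block p (M * X))) K∣uₛ))

    rank : Rank K (M * (P * P) * p)
    rank = record
      { T≢0 = m*n≢0 (M * (P * P)) p {{m*n≢0 M (P * P)}}
      ; K∣uT = subst₂ _∣_ (sym K≡) (sym (u-block p (M * (P * P)))) (*-monoʳ-∣ P (PP∣⇒PPS∣ω (P * P) ∣-refl))
      ; least = K∣u⇒∣
      }

    rank-formula : p * p * (M * (P * P) * p) ≡ m * p * (m₁ * p) * (m₂ * p) * (P * P)
    rank-formula = lemma m p P
      where
      lemma : ∀ m p P → p * p * (m * (1 + m) * (2 + m) * (P * P) * p) ≡ m * p * ((1 + m) * p) * ((2 + m) * p) * (P * P)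
      lemma = ℕ-Solver.solve-∀

  module EvenCoprime (n₁ p : ℕ) .{{_ : NonZero n₁}} (pp : Prime p) (p≥3 : 3 ≤ p) (p∤n₁ : ¬ p ∣ n₁) where

    n₂ N₂ A W₁ W₂ : ℕ
    n₂ = n₁ + p
    N₂ = n₁ * 2 + p
    A = u 2
    W₁ = ω 2 n₁
    W₂ = ω 2 n₂

    instance
      A≢0 : NonZero A
      A≢0 = u-nonZero 2
      n₂≢0 : NonZero n₂
      n₂≢0 = +-nonZero n₁ p
      N₂≢0 : NonZero N₂
      N₂≢0 = +-nonZero (n₁ * 2) p {{m*n≢0 n₁ 2}}
      n₁n₂≢0 : NonZero (n₁ * n₂)
      n₁n₂≢0 = m*n≢0 n₁ n₂
      W₁W₂≢0 : NonZero (W₁ * W₂)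
      W₁W₂≢0 = m*n≢0 W₁ W₂
      AW₁W₂≢0 : NonZero (A * W₁ * W₂)
      AW₁W₂≢0 = m*n≢0 (A * W₁) W₂ {{m*n≢0 A W₁}}

    p∤n₁*2 : ¬ p ∣ n₁ * 2
    p∤n₁*2 p∣n₁*2 with euclidsLemma n₁ 2 pp p∣n₁*2
    ... | inj₁ p∣n₁ = p∤n₁ p∣n₁
    ... | inj₂ p∣2 = ≥3⇒≢2 p≥3 (prime∣prime⇒≡ pp prime[2] p∣2)

    common⇒p : ∀ {q x} → Prime q → q ∣ x → q ∣ x + p → q ≡ p
    common⇒p pq q∣x q∣x+p = prime∣prime⇒≡ pq pp (∣m+n∣m⇒∣n q∣x+p q∣x)

    n₁⊥n₂ : Coprime n₁ n₂
    n₁⊥n₂ = coprime-by-primes λ q pq q∣n₁ q∣n₂ → p∤n₁ (subst (_∣ n₁) (common⇒p pq q∣n₁ q∣n₂) q∣n₁)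

    N₁⊥N₂ : Coprime (n₁ * 2) N₂
    N₁⊥N₂ = coprime-by-primes λ q pq q∣N₁ q∣N₂ → p∤n₁*2 (subst (_∣ n₁ * 2) (common⇒p pq q∣N₁ q∣N₂) q∣N₁)

    N₃≡N₂+p : n₂ * 2 ≡ N₂ + p
    N₃≡N₂+p = lemma n₁ p
      where
      lemma : ∀ n p → (n + p) * 2 ≡ n * 2 + p + p
      lemma = ℕ-Solver.solve-∀

    N₃⊥N₂ : Coprime (n₂ * 2) N₂
    N₃⊥N₂ = coprime-by-primes λ q pq q∣N₃ q∣N₂ →
      let p∣N₂ = subst (_∣ N₂) (common⇒p pq q∣N₂ (subst (q ∣_) N₃≡N₂+p q∣N₃)) q∣N₂
      in p∤n₁*2 (∣m+n∣m⇒∣n (subst (p ∣_) (+-comm (n₁ * 2) p) p∣N₂) ∣-refl)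

    N₂⊥n₁n₂2 : Coprime N₂ (n₁ * n₂ * 2)
    N₂⊥n₁n₂2 = coprime-by-primes λ q pq q∣N₂ q∣n₁n₂2 → case euclidsLemma (n₁ * n₂) 2 pq q∣n₁n₂2 of λ where
      (inj₂ q∣2) → ≥3⇒≢2 p≥3 (sym (prime∣prime⇒≡ prime[2] pp
                     (∣m+n∣m⇒∣n (subst (_∣ N₂) (prime∣prime⇒≡ pq prime[2] q∣2) q∣N₂) (n∣m*n n₁))))
      (inj₁ q∣n₁n₂) → case euclidsLemma n₁ n₂ pq q∣n₁n₂ of λ where
        (inj₁ q∣n₁) → coprime-prime N₁⊥N₂ pq (∣m⇒∣m*n 2 q∣n₁) q∣N₂
        (inj₂ q∣n₂) → coprime-prime N₃⊥N₂ pq (∣m⇒∣m*n 2 q∣n₂) q∣N₂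

    W₁W₂∣ω : ∀ X → W₁ * W₂ ∣ ω 2 (n₁ * n₂ * X)
    W₁W₂∣ω X = coprime-*-∣ (coprime-ω n₁⊥n₂) (ω-∣ (∣-trans (m∣m*n n₂) (m∣m*n X)))
                                             (ω-∣ (∣-trans (n∣m*n n₁) (m∣m*n X)))

    module _ {q} (pq : Prime q) (q∣A : q ∣ A) where

      ν-AW₁W₂ : ν q (A * W₁ * W₂) ≡ ν q A + (ν q n₁ + ν q n₂)
      ν-AW₁W₂ = trans (ν-*-* pq A W₁ W₂)
                (trans (cong₂ (λ x y → ν q A + x + y) (ν-ω≡ν pq q∣A (inj₂ ∣-refl) n₁) (ν-ω≡ν pq q∣A (inj₂ ∣-refl) n₂))
                       (+-assoc (ν q A) _ _))

      ν-ω-n₁n₂ : ∀ X → .{{NonZero X}} → ν q (ω 2 (n₁ * n₂ * X)) ≡ ν q X + (ν q n₁ + ν q n₂)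
      ν-ω-n₁n₂ X = trans (ν-ω≡ν pq q∣A (inj₂ ∣-refl) (n₁ * n₂ * X) {{m*n≢0 (n₁ * n₂) X}})
              (trans (ν-* pq (n₁ * n₂) X) (trans (cong (_+ ν q X) (ν-* pq n₁ n₂)) (+-comm _ (ν q X))))

    AW₁W₂∣ω⇒A∣ : ∀ X → .{{NonZero X}} → A * W₁ * W₂ ∣ ω 2 (n₁ * n₂ * X) → A ∣ X
    AW₁W₂∣ω⇒A∣ X AW∣ω = ∣-by-ν ν≤
      where
      instance
        n₁n₂X≢0 : NonZero (n₁ * n₂ * X)
        n₁n₂X≢0 = m*n≢0 (n₁ * n₂) X
      ν≤ : ∀ q → Prime q → ν q A ≤ ν q X
      ν≤ q pq with q ∣? A
      ... | no q∤A = subst (_≤ ν q X) (sym (ν-∤ (prime≥2 pq) q∤A)) z≤n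
      ... | yes q∣A = +-cancelʳ-≤ _ (ν q A) (ν q X)
                        (subst₂ _≤_ (ν-AW₁W₂ pq q∣A) (ν-ω-n₁n₂ pq q∣A X) (ν-mono pq AW∣ω))

    A∣⇒AW₁W₂∣ω : ∀ X → .{{NonZero X}} → A ∣ X → A * W₁ * W₂ ∣ ω 2 (n₁ * n₂ * X)
    A∣⇒AW₁W₂∣ω X A∣X = ∣-by-ν ν≤
      where
      instance
        n₁n₂X≢0 : NonZero (n₁ * n₂ * X)
        n₁n₂X≢0 = m*n≢0 (n₁ * n₂) X
      ν≤ : ∀ q → Prime q → ν q (A * W₁ * W₂) ≤ ν q (ω 2 (n₁ * n₂ * X))
      ν≤ q pq with q ∣? A
      ... | yes q∣A = subst₂ _≤_ (sym (ν-AW₁W₂ pq q∣A)) (sym (ν-ω-n₁n₂ pq q∣A X)) (+-monoˡ-≤ _ (ν-mono pq A∣X))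
      ... | no q∤A = begin
        ν q (A * W₁ * W₂)         ≡⟨ cong (ν q) (*-assoc A W₁ W₂) ⟩
        ν q (A * (W₁ * W₂))       ≡⟨ ν-* pq A (W₁ * W₂) ⟩
        ν q A + ν q (W₁ * W₂)     ≡⟨ cong (_+ ν q (W₁ * W₂)) (ν-∤ (prime≥2 pq) q∤A) ⟩
        ν q (W₁ * W₂)             ≤⟨ ν-mono pq (W₁W₂∣ω X) ⟩
        ν q (ω 2 (n₁ * n₂ * X))   ∎
        where open ≤-Reasoning

    K L : ℕ
    K = u (n₁ * 2) * u N₂ * u (n₂ * 2)
    L = lcm A N₂

    uN₁uN₃≡ : u (n₁ * 2) * u (n₂ * 2) ≡ A * (A * W₁ * W₂)
    uN₁uN₃≡ = trans (cong₂ _*_ (u-block 2 n₁) (u-block 2 n₂)) (lemma A W₁ W₂)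
      where
      lemma : ∀ a x y → a * x * (a * y) ≡ a * (a * x * y)
      lemma = ℕ-Solver.solve-∀

    uN₁uN₃∣K : u (n₁ * 2) * u (n₂ * 2) ∣ K
    uN₁uN₃∣K = divides (u N₂) (lemma (u (n₁ * 2)) (u N₂) (u (n₂ * 2)))
      where
      lemma : ∀ x y z → x * y * z ≡ y * (x * z)
      lemma = ℕ-Solver.solve-∀

    n₂*2≢2 : n₂ * 2 ≢ 2
    n₂*2≢2 = ≥3⇒≢2 (≤-trans p≥3 (≤-trans (m≤n+m p n₁) (m≤m*n n₂ 2)))

    N₂≢2 : N₂ ≢ 2
    N₂≢2 = ≥3⇒≢2 (≤-trans p≥3 (m≤n+m p (n₁ * 2)))

    K∣u⇒∣ : ∀ s → .{{NonZero s}} → K ∣ u s → n₁ * n₂ * L * 2 ∣ s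
    K∣u⇒∣ s K∣uₛ =
      subst (n₁ * n₂ * L * 2 ∣_) (sym s≡n₁n₂t2) (*-monoˡ-∣ 2 (*-monoʳ-∣ (n₁ * n₂) (lcm-least A∣t N₂∣t)))
      where
      n₂2∣s : n₂ * 2 ∣ s
      n₂2∣s = u∣u⇒∣ n₂*2≢2 (∣-trans (n∣m*n (u (n₁ * 2) * u N₂)) K∣uₛ)
      N₂∣s : N₂ ∣ s
      N₂∣s = u∣u⇒∣ N₂≢2 (∣-trans (n∣m*n*o (u (n₁ * 2)) (u (n₂ * 2))) K∣uₛ)
      2∣s : 2 ∣ s
      2∣s = ∣-trans (n∣m*n n₂) n₂2∣s
      s₁ = quotient 2∣s
      s≡s₁2 : s ≡ s₁ * 2
      s≡s₁2 = m∣n⇒n≡quotient*m 2∣s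
      instance
        s₁≢0 : NonZero s₁
        s₁≢0 = quotient≢0 2∣s
      ∣s₁ : ∀ {x} → x * 2 ∣ s → x ∣ s₁
      ∣s₁ {x} x2∣s = *-cancelʳ-∣ 2 (subst (x * 2 ∣_) s≡s₁2 x2∣s)
      n₁∣s₁ : n₁ ∣ s₁
      n₁∣s₁ with n₁ ≟ 1
      ... | yes n₁≡1 = subst (_∣ s₁) (sym n₁≡1) (1∣ s₁)
      ... | no n₁≢1 = ∣s₁ (u∣u⇒∣ (λ n₁2≡2 → n₁≢1 (*-cancelʳ-≡ n₁ 1 2 n₁2≡2))
                                (∣-trans (m∣m*n*o (u (n₁ * 2)) (u N₂) _) K∣uₛ))
      n₁n₂∣s₁ : n₁ * n₂ ∣ s₁
      n₁n₂∣s₁ = coprime-*-∣ n₁⊥n₂ n₁∣s₁ (∣s₁ n₂2∣s)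
      t = quotient n₁n₂∣s₁
      instance
        t≢0 : NonZero t
        t≢0 = quotient≢0 n₁n₂∣s₁
      s≡n₁n₂t2 : s ≡ n₁ * n₂ * t * 2
      s≡n₁n₂t2 = trans s≡s₁2 (cong (_* 2) (m∣n⇒n≡m*quotient n₁n₂∣s₁))
      N₂∣t : N₂ ∣ t
      N₂∣t = coprime-divisor N₂⊥n₁n₂2 (subst (N₂ ∣_) (trans s≡n₁n₂t2 (lemma n₁ n₂ t)) N₂∣s)
        where
        lemma : ∀ x y t → x * y * t * 2 ≡ x * y * 2 * t
        lemma = ℕ-Solver.solve-∀
      A∣t : A ∣ t
      A∣t = AW₁W₂∣ω⇒A∣ t (*-cancelˡ-∣ A (subst₂ _∣_ uN₁uN₃≡ (trans (cong u s≡n₁n₂t2) (u-block 2 (n₁ * n₂ * t)))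
                                                     (∣-trans uN₁uN₃∣K K∣uₛ)))

    instance
      L≢0 : NonZero L
      L≢0 = m*n≢0⇒n≢0 (gcd A N₂) {{subst NonZero (sym (gcd*lcm A N₂)) (m*n≢0 A N₂)}}

    rank : Rank K (n₁ * n₂ * L * 2)
    rank = record
      { T≢0 = m*n≢0 (n₁ * n₂ * L) 2 {{m*n≢0 (n₁ * n₂) L}}
      ; K∣uT = subst (_∣ u (n₁ * n₂ * L * 2)) reorder
                 (coprime-*-∣ (coprime-*ˡ (coprime-u N₁⊥N₂) (coprime-u N₃⊥N₂)) uN₁uN₃∣uT uN₂∣uT)
      ; least = K∣u⇒∣
      }
      where
      uN₁uN₃∣uT : u (n₁ * 2) * u (n₂ * 2) ∣ u (n₁ * n₂ * L * 2)
      uN₁uN₃∣uT = subst₂ _∣_ (sym uN₁uN₃≡) (sym (u-block 2 (n₁ * n₂ * L)))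
                    (*-monoʳ-∣ A (A∣⇒AW₁W₂∣ω L (m∣lcm[m,n] A N₂)))
      uN₂∣uT : u N₂ ∣ u (n₁ * n₂ * L * 2)
      uN₂∣uT = u∣u (∣-trans (n∣lcm[m,n] A N₂) (∣-trans (n∣m*n (n₁ * n₂)) (m∣m*n 2)))
      reorder : u (n₁ * 2) * u (n₂ * 2) * u N₂ ≡ K
      reorder = lemma (u (n₁ * 2)) (u (n₂ * 2)) (u N₂)
        where
        lemma : ∀ x z y → x * z * y ≡ x * y * z
        lemma = ℕ-Solver.solve-∀

    rank-formula : 2 * gcd A N₂ * (n₁ * n₂ * L * 2) ≡ n₁ * 2 * N₂ * (n₂ * 2) * A
    rank-formula = begin
      2 * gcd A N₂ * (n₁ * n₂ * L * 2)        ≡⟨ lemma₁ (gcd A N₂) n₁ n₂ L ⟩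
      n₁ * 2 * (n₂ * 2) * (gcd A N₂ * L)      ≡⟨ cong (n₁ * 2 * (n₂ * 2) *_) (gcd*lcm A N₂) ⟩
      n₁ * 2 * (n₂ * 2) * (A * N₂)            ≡⟨ lemma₂ n₁ n₂ A N₂ ⟩
      n₁ * 2 * N₂ * (n₂ * 2) * A              ∎
      where
      open ≡-Reasoning
      lemma₁ : ∀ g x y l → 2 * g * (x * y * l * 2) ≡ x * 2 * (y * 2) * (g * l)
      lemma₁ = ℕ-Solver.solve-∀
      lemma₂ : ∀ x y a m → x * 2 * (y * 2) * (a * m) ≡ x * 2 * m * (y * 2) * a
      lemma₂ = ℕ-Solver.solve-∀

  module EvenMultiple (h p : ℕ) .{{_ : NonZero h}} (pp : Prime p) (p≥3 : 3 ≤ p) where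

    D k P Vₚ g E N Z₁ Z₂ W S : ℕ
    D = 2 * p
    k = suc (2 * h)
    P = u p
    Vₚ = v p
    g = gcd Vₚ k
    E = quotient (gcd[m,n]∣m Vₚ k)
    N = h * suc h * k
    Z₁ = ω D h
    Z₂ = ω D (suc h)
    W = ω p k
    S = Z₁ * Z₂ * W

    Vₚ≡Eg : Vₚ ≡ E * g
    Vₚ≡Eg = m∣n⇒n≡quotient*m (gcd[m,n]∣m Vₚ k)

    instance
      p≢0 : NonZero p
      p≢0 = prime⇒nonZero pp
      D≢0 : NonZero D
      D≢0 = m*n≢0 2 p
      P≢0 : NonZero P
      P≢0 = u-nonZero p
      Vₚ≢0 : NonZero Vₚ
      Vₚ≢0 = v-nonZero p
      E≢0 : NonZero E
      E≢0 = quotient≢0 (gcd[m,n]∣m Vₚ k)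
      N≢0 : NonZero N
      N≢0 = m*n≢0 (h * suc h) k {{m*n≢0 h (suc h)}}
      PP≢0 : NonZero (P * P)
      PP≢0 = m*n≢0 P P
      PPVₚ≢0 : NonZero (P * P * Vₚ)
      PPVₚ≢0 = m*n≢0 (P * P) Vₚ
      PPE≢0 : NonZero (P * P * E)
      PPE≢0 = m*n≢0 (P * P) E
      S≢0 : NonZero S
      S≢0 = m*n≢0 (Z₁ * Z₂) W {{m*n≢0 Z₁ Z₂}}

    uD≡PVₚ : u D ≡ P * Vₚ
    uD≡PVₚ = trans (u-block p 2) (cong (P *_) (ω-2 p))

    k-odd : ¬ 2 ∣ k
    k-odd 2∣k = contradiction (∣1⇒≡1 (∣m+n∣m⇒∣n (subst (2 ∣_) (+-comm 1 (2 * h)) 2∣k) (m∣m*n h))) λ ()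

    2h+2≡k+1 : 2 * suc h ≡ suc k
    2h+2≡k+1 = lemma h
      where
      lemma : ∀ h → 2 * (1 + h) ≡ 2 + 2 * h
      lemma = ℕ-Solver.solve-∀

    h⊥h+1 : Coprime h (suc h)
    h⊥h+1 = coprime-suc h
    h⊥k : Coprime h k
    h⊥k (d∣h , d∣k) = coprime-suc (2 * h) (∣-trans d∣h (n∣m*n 2) , d∣k)
    2h+2⊥k : Coprime (2 * suc h) k
    2h+2⊥k = subst (λ x → Coprime x k) (sym 2h+2≡k+1) (Coprime.sym (coprime-suc k))
    h+1⊥k : Coprime (suc h) k
    h+1⊥k (d∣h+1 , d∣k) = 2h+2⊥k (∣-trans d∣h+1 (n∣m*n 2) , d∣k)
    k⊥2 : Coprime k 2
    k⊥2 = coprime-by-primes λ q pq q∣k q∣2 → k-odd (subst (_∣ k) (prime∣prime⇒≡ pq prime[2] q∣2) q∣k)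

    gcd-N₁-N₂ : gcd (h * D) (k * p) ≡ p
    gcd-N₁-N₂ = trans (cong₂ gcd (lemma h p) (*-comm k p)) (gcd-*-coprime p (coprime-suc (2 * h)))
      where
      lemma : ∀ h p → h * (2 * p) ≡ p * (2 * h)
      lemma = ℕ-Solver.solve-∀

    gcd-N₃-N₂ : gcd (suc h * D) (k * p) ≡ p
    gcd-N₃-N₂ = trans (cong₂ gcd (lemma h p) (*-comm k p)) (gcd-*-coprime p 2h+2⊥k)
      where
      lemma : ∀ h p → (1 + h) * (2 * p) ≡ p * (2 * (1 + h))
      lemma = ℕ-Solver.solve-∀

    gcd-N₂-D : gcd (k * p) D ≡ p
    gcd-N₂-D = trans (cong₂ gcd (*-comm k p) (*-comm 2 p)) (gcd-*-coprime p k⊥2)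

    common-prime⇒∣P : ∀ {q} x y → q ∣ u x → q ∣ u y → gcd x y ≡ p → q ∣ P
    common-prime⇒∣P {q} x y q∣uₓ q∣uᵧ gcd≡p = subst (λ i → q ∣ u i) gcd≡p (∣u-gcd x y q∣uₓ q∣uᵧ)

    q∣Z₁⇒q∣uN₁ : ∀ {q} → q ∣ Z₁ → q ∣ u (h * D)
    q∣Z₁⇒q∣uN₁ q∣Z₁ = subst (_ ∣_) (sym (u-block D h)) (∣n⇒∣m*n (u D) q∣Z₁)
    q∣Z₂⇒q∣uN₃ : ∀ {q} → q ∣ Z₂ → q ∣ u (suc h * D)
    q∣Z₂⇒q∣uN₃ q∣Z₂ = subst (_ ∣_) (sym (u-block D (suc h))) (∣n⇒∣m*n (u D) q∣Z₂)
    q∣W⇒q∣uN₂ : ∀ {q} → q ∣ W → q ∣ u (k * p)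
    q∣W⇒q∣uN₂ q∣W = subst (_ ∣_) (sym (u-block p k)) (∣n⇒∣m*n P q∣W)

    P∣uD : P ∣ u D
    P∣uD = u∣u {p} {D} (n∣m*n 2)

    Z₁⊥W : Coprime Z₁ W
    Z₁⊥W = coprime-by-primes λ q pq q∣Z₁ q∣W →
      let q∣P = common-prime⇒∣P (h * D) (k * p) (q∣Z₁⇒q∣uN₁ q∣Z₁) (q∣W⇒q∣uN₂ q∣W) gcd-N₁-N₂
      in coprime-prime h⊥k pq (∣ω⇒∣ pq (∣-trans q∣P P∣uD) q∣Z₁) (∣ω⇒∣ pq q∣P q∣W)

    Z₂⊥W : Coprime Z₂ W
    Z₂⊥W = coprime-by-primes λ q pq q∣Z₂ q∣W →
      let q∣P = common-prime⇒∣P (suc h * D) (k * p) (q∣Z₂⇒q∣uN₃ q∣Z₂) (q∣W⇒q∣uN₂ q∣W) gcd-N₃-N₂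
      in coprime-prime h+1⊥k pq (∣ω⇒∣ pq (∣-trans q∣P P∣uD) q∣Z₂) (∣ω⇒∣ pq q∣P q∣W)

    D-even : 2 ∣ D
    D-even = m∣m*n p

    S∣Vₚω : ∀ X → S ∣ Vₚ * ω D (N * X)
    S∣Vₚω X = coprime-*-*-∣ (coprime-ω h⊥h+1) Z₁⊥W Z₂⊥W
                (∣-trans (ω-∣ (∣-trans (m∣m*n*o h (suc h) k) (m∣m*n X))) (n∣m*n Vₚ))
                (∣-trans (ω-∣ (∣-trans (n∣m*n*o h k) (m∣m*n X))) (n∣m*n Vₚ))
                W∣Vₚω
      where
      kp∣NXD : k * p ∣ N * X * D
      kp∣NXD = divides (h * suc h * X * 2) (lemma h k X p)
        where
        lemma : ∀ h k x p → h * (1 + h) * k * x * (2 * p) ≡ h * (1 + h) * x * 2 * (k * p)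
        lemma = ℕ-Solver.solve-∀
      W∣Vₚω : W ∣ Vₚ * ω D (N * X)
      W∣Vₚω = *-cancelˡ-∣ P (subst₂ _∣_ (u-block p k) uNXD≡ (u∣u kp∣NXD))
        where
        uNXD≡ : u (N * X * D) ≡ P * (Vₚ * ω D (N * X))
        uNXD≡ = trans (u-block D (N * X)) (trans (cong (_* ω D (N * X)) uD≡PVₚ) (*-assoc P Vₚ _))

    q∣uD⇒q∣P∨Vₚ : ∀ {q} → Prime q → q ∣ u D → ¬ q ∣ P → q ∣ Vₚ
    q∣uD⇒q∣P∨Vₚ pq q∣uD q∤P with euclidsLemma P Vₚ pq (subst (_ ∣_) uD≡PVₚ q∣uD)
    ... | inj₁ q∣P = contradiction q∣P q∤P
    ... | inj₂ q∣Vₚ = q∣Vₚ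

    ν-W-at-P : ∀ {q} → Prime q → q ∣ P → ν q W ≡ ν q k
    ν-W-at-P {q} pq q∣P with q ≟ 2
    ... | no q≢2 = ν-ω≡ν pq q∣P (inj₁ q≢2) k
    ... | yes refl = trans (ν-ω-∤ prime[2] q∣P k-odd) (sym (ν-∤ ≤-refl k-odd))

    ν-W-off-P : ∀ {q} → Prime q → ¬ q ∣ P → q ∣ Vₚ → ν q W ≡ 0
    ν-W-off-P pq q∤P q∣Vₚ = ν-∤ (prime≥2 pq) λ q∣W →
      q∤P (common-prime⇒∣P (k * p) D (q∣W⇒q∣uN₂ q∣W) (∣-trans q∣Vₚ (subst (Vₚ ∣_) (sym uD≡PVₚ) (n∣m*n P))) gcd-N₂-D)

    ν-g-at-P : ∀ {q} → Prime q → q ∣ P → ν q g ≡ 0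
    ν-g-at-P pq q∣P = ν-∤ (prime≥2 pq) {{g≢0}} λ q∣g →
      k-odd (subst (_∣ k) (prime∣u∧v⇒≡2 {n = p} pq q∣P (∣-trans q∣g (gcd[m,n]∣m Vₚ k))) (∣-trans q∣g (gcd[m,n]∣n Vₚ k)))
      where
      g≢0 = m*n≢0⇒n≢0 E {{subst NonZero Vₚ≡Eg it}}

    module _ {q} (pq : Prime q) (q∣uD : q ∣ u D) where

      ν-PPVₚS : ν q (P * P * Vₚ * S) ≡ ν q h + ν q (suc h) + (ν q (P * P * Vₚ) + ν q W)
      ν-PPVₚS = begin
        ν q (P * P * Vₚ * S)                                ≡⟨ ν-* pq (P * P * Vₚ) S ⟩
        ν q (P * P * Vₚ) + ν q S                            ≡⟨ cong (ν q (P * P * Vₚ) +_) (ν-*-* pq Z₁ Z₂ W) ⟩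
        ν q (P * P * Vₚ) + (ν q Z₁ + ν q Z₂ + ν q W)
          ≡⟨ cong₂ (λ x y → ν q (P * P * Vₚ) + (x + y + ν q W))
                   (ν-ω≡ν pq q∣uD (inj₂ D-even) h) (ν-ω≡ν pq q∣uD (inj₂ D-even) (suc h)) ⟩
        ν q (P * P * Vₚ) + (ν q h + ν q (suc h) + ν q W)    ≡⟨ lemma (ν q (P * P * Vₚ)) (ν q h) (ν q (suc h)) (ν q W) ⟩
        ν q h + ν q (suc h) + (ν q (P * P * Vₚ) + ν q W)    ∎
        where
        open ≡-Reasoning
        lemma : ∀ a x y w → a + (x + y + w) ≡ x + y + (a + w)
        lemma = ℕ-Solver.solve-∀

      ν-ωD : ∀ X → .{{NonZero X}} → ν q (ω D (N * X)) ≡ ν q h + ν q (suc h) + (ν q k + ν q X)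
      ν-ωD X = begin
        ν q (ω D (N * X))                    ≡⟨ ν-ω≡ν pq q∣uD (inj₂ D-even) (N * X) {{m*n≢0 N X}} ⟩
        ν q (N * X)                          ≡⟨ ν-* pq N X ⟩
        ν q N + ν q X                        ≡⟨ cong (_+ ν q X) (ν-*-* pq h (suc h) k) ⟩
        ν q h + ν q (suc h) + ν q k + ν q X  ≡⟨ +-assoc (ν q h + ν q (suc h)) (ν q k) (ν q X) ⟩
        ν q h + ν q (suc h) + (ν q k + ν q X) ∎
        where open ≡-Reasoning

    ν-PP≡0 : ∀ {q} → Prime q → ¬ q ∣ P → ν q (P * P) ≡ 0
    ν-PP≡0 pq q∤P = ν-∤ (prime≥2 pq) λ q∣PP → case euclidsLemma P P pq q∣PP of λ where
      (inj₁ q∣P) → q∤P q∣P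
      (inj₂ q∣P) → q∤P q∣P

    ν-PPVₚ≡0 : ∀ {q} → Prime q → ¬ q ∣ u D → ν q (P * P * Vₚ) ≡ 0
    ν-PPVₚ≡0 pq q∤uD = ν-∤ (prime≥2 pq) λ q∣PPVₚ → case euclidsLemma (P * P) Vₚ pq q∣PPVₚ of λ where
      (inj₁ q∣PP) → case euclidsLemma P P pq q∣PP of λ where
        (inj₁ q∣P) → q∤uD (∣-trans q∣P P∣uD)
        (inj₂ q∣P) → q∤uD (∣-trans q∣P P∣uD)
      (inj₂ q∣Vₚ) → q∤uD (subst (_ ∣_) (sym uD≡PVₚ) (∣n⇒∣m*n P q∣Vₚ))

    instance
      g≢0 : NonZero g
      g≢0 = m*n≢0⇒n≢0 E {{subst NonZero Vₚ≡Eg it}}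

    PPVₚ≡PPEg : P * P * Vₚ ≡ P * P * E * g
    PPVₚ≡PPEg = trans (cong (P * P *_) Vₚ≡Eg) (sym (*-assoc (P * P) E g))

    PPVₚS∣ω⇒PPE∣ : ∀ X → .{{NonZero X}} → P * P * Vₚ * S ∣ ω D (N * X) → P * P * E ∣ X
    PPVₚS∣ω⇒PPE∣ X PPVₚS∣ω = *-cancelʳ-∣ g (subst (_∣ X * g) PPVₚ≡PPEg PPVₚ∣Xg)
      where
      instance
        NX≢0 : NonZero (N * X)
        NX≢0 = m*n≢0 N X
        Xk≢0 : NonZero (X * k)
        Xk≢0 = m*n≢0 X k
      at-uD : ∀ {q} → Prime q → q ∣ u D → ν q (P * P * Vₚ) + ν q W ≤ ν q k + ν q X
      at-uD {q} pq q∣uD = +-cancelˡ-≤ (ν q h + ν q (suc h)) _ _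
                            (subst₂ _≤_ (ν-PPVₚS pq q∣uD) (ν-ωD pq q∣uD X) (ν-mono pq PPVₚS∣ω))
      ν≤-PP : ∀ q → Prime q → ν q (P * P) ≤ ν q X
      ν≤-PP q pq with q ∣? P
      ... | no q∤P = subst (_≤ ν q X) (sym (ν-PP≡0 pq q∤P)) z≤n
      ... | yes q∣P = ≤-trans (ν-mono pq (m∣m*n {P * P} Vₚ))
                        (+-cancelʳ-≤ (ν q k) (ν q (P * P * Vₚ)) (ν q X) (subst₂ _≤_ (cong (ν q (P * P * Vₚ) +_) (ν-W-at-P pq q∣P)) (+-comm (ν q k) (ν q X))
                                                           (at-uD pq (∣-trans q∣P P∣uD))))
      ν≤-PPVₚ : ∀ q → Prime q → ν q (P * P * Vₚ) ≤ ν q (X * k)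
      ν≤-PPVₚ q pq with q ∣? u D
      ... | no q∤uD = subst (_≤ ν q (X * k)) (sym (ν-PPVₚ≡0 pq q∤uD)) z≤n
      ... | yes q∣uD = ≤-trans (m≤m+n (ν q (P * P * Vₚ)) (ν q W))
                         (≤-trans (at-uD pq q∣uD) (≤-reflexive (trans (+-comm (ν q k) (ν q X)) (sym (ν-* pq X k)))))
      PPVₚ∣Xg : P * P * Vₚ ∣ X * g
      PPVₚ∣Xg = subst (P * P * Vₚ ∣_) (sym (c*gcd[m,n]≡gcd[cm,cn] X Vₚ k))
                  (gcd-greatest {X * Vₚ} {X * k} (*-monoˡ-∣ Vₚ (∣-by-ν {P * P} {X} ν≤-PP))
                                                 (∣-by-ν {P * P * Vₚ} {X * k} ν≤-PPVₚ))

    PPE∣⇒PPVₚS∣ω : ∀ X → .{{NonZero X}} → P * P * E ∣ X → P * P * Vₚ * S ∣ ω D (N * X)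
    PPE∣⇒PPVₚS∣ω X PPE∣X = ∣-by-ν {P * P * Vₚ * S} {ω D (N * X)} {{m*n≢0 (P * P * Vₚ) S}} ν≤
      where
      instance
        NX≢0 : NonZero (N * X)
        NX≢0 = m*n≢0 N X
      at-uD : ∀ {q} → Prime q → q ∣ u D → ν q (P * P * Vₚ) + ν q W ≤ ν q k + ν q X
      at-uD {q} pq q∣uD with q ∣? P
      ... | yes q∣P = begin
        ν q (P * P * Vₚ) + ν q W    ≡⟨ cong₂ _+_ ν-PPVₚ≡ν-PPE (ν-W-at-P pq q∣P) ⟩
        ν q (P * P * E) + ν q k     ≤⟨ +-monoˡ-≤ (ν q k) (ν-mono pq PPE∣X) ⟩
        ν q X + ν q k               ≡⟨ +-comm (ν q X) (ν q k) ⟩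
        ν q k + ν q X               ∎
        where
        open ≤-Reasoning
        ν-PPVₚ≡ν-PPE : ν q (P * P * Vₚ) ≡ ν q (P * P * E)
        ν-PPVₚ≡ν-PPE = trans (cong (ν q) PPVₚ≡PPEg)
                       (trans (ν-* pq (P * P * E) g) (trans (cong (ν q (P * P * E) +_) (ν-g-at-P pq q∣P)) (+-identityʳ _)))
      ... | no q∤P = begin
        ν q (P * P * Vₚ) + ν q W    ≡⟨ cong₂ _+_ (trans (ν-* pq (P * P) Vₚ) (cong (_+ ν q Vₚ) (ν-PP≡0 pq q∤P)))
                                                 (ν-W-off-P pq q∤P (q∣uD⇒q∣P∨Vₚ pq q∣uD q∤P)) ⟩
        ν q Vₚ + 0                  ≡⟨ trans (+-identityʳ (ν q Vₚ)) (trans (cong (ν q) Vₚ≡Eg) (ν-* pq E g)) ⟩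
        ν q E + ν q g               ≤⟨ +-mono-≤ (ν-mono pq (∣-trans (n∣m*n (P * P)) PPE∣X)) (ν-mono pq (gcd[m,n]∣n Vₚ k)) ⟩
        ν q X + ν q k               ≡⟨ +-comm (ν q X) (ν q k) ⟩
        ν q k + ν q X               ∎
        where open ≤-Reasoning
      ν≤ : ∀ q → Prime q → ν q (P * P * Vₚ * S) ≤ ν q (ω D (N * X))
      ν≤ q pq with q ∣? u D
      ... | yes q∣uD = subst₂ _≤_ (sym (ν-PPVₚS pq q∣uD)) (sym (ν-ωD pq q∣uD X))
                                  (+-monoʳ-≤ (ν q h + ν q (suc h)) (at-uD pq q∣uD))
      ... | no q∤uD = begin
        ν q (P * P * Vₚ * S)              ≡⟨ ν-* pq (P * P * Vₚ) S ⟩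
        ν q (P * P * Vₚ) + ν q S          ≡⟨ cong (_+ ν q S) (ν-PPVₚ≡0 pq q∤uD) ⟩
        ν q S                             ≤⟨ ν-mono pq {{m*n≢0 Vₚ (ω D (N * X))}} (S∣Vₚω X) ⟩
        ν q (Vₚ * ω D (N * X))            ≡⟨ ν-* pq Vₚ (ω D (N * X)) ⟩
        ν q Vₚ + ν q (ω D (N * X))        ≡⟨ cong (_+ ν q (ω D (N * X))) (ν-∤ (prime≥2 pq) q∤Vₚ) ⟩
        ν q (ω D (N * X))                 ∎
        where
        open ≤-Reasoning
        q∤Vₚ : ¬ q ∣ Vₚ
        q∤Vₚ q∣Vₚ = q∤uD (subst (q ∣_) (sym uD≡PVₚ) (∣n⇒∣m*n P q∣Vₚ))

    K T : ℕ
    K = u (h * D) * u (k * p) * u (suc h * D)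
    T = N * (P * P * E) * D

    u-*D : ∀ Y → u (Y * D) ≡ P * Vₚ * ω D Y
    u-*D Y = trans (u-block D Y) (cong (_* ω D Y) uD≡PVₚ)

    K≡ : K ≡ P * Vₚ * (P * P * Vₚ * S)
    K≡ = trans (cong₂ (λ x y → x * y * u (suc h * D)) (u-*D h) (u-block p k))
         (trans (cong (P * Vₚ * Z₁ * (P * W) *_) (u-*D (suc h))) (lemma P Vₚ Z₁ Z₂ W))
      where
      lemma : ∀ P V z₁ z₂ w → P * V * z₁ * (P * w) * (P * V * z₂) ≡ P * V * (P * P * V * (z₁ * z₂ * w))
      lemma = ℕ-Solver.solve-∀

    K∣u⇒∣ : ∀ s → .{{NonZero s}} → K ∣ u s → T ∣ s
    K∣u⇒∣ s K∣uₛ = subst (T ∣_) (sym s≡NXD) (*-monoˡ-∣ D (*-monoʳ-∣ N (PPVₚS∣ω⇒PPE∣ X PPVₚS∣ω)))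
      where
      3≤D : 3 ≤ D
      3≤D = ≤-trans p≥3 (m≤n*m p 2)
      hD∣s : h * D ∣ s
      hD∣s = u∣u⇒∣ (≥3⇒≢2 (≤-trans 3≤D (m≤n*m D h))) (∣-trans (m∣m*n*o (u (h * D)) (u (k * p)) _) K∣uₛ)
      kp∣s : k * p ∣ s
      kp∣s = u∣u⇒∣ (≥3⇒≢2 (≤-trans p≥3 (m≤n*m p k))) (∣-trans (n∣m*n*o (u (h * D)) _) K∣uₛ)
      h+1D∣s : suc h * D ∣ s
      h+1D∣s = u∣u⇒∣ (≥3⇒≢2 (≤-trans 3≤D (m≤n*m D (suc h)))) (∣-trans (n∣m*n (u (h * D) * u (k * p))) K∣uₛ)
      D∣s : D ∣ s
      D∣s = ∣-trans (n∣m*n h) hD∣s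
      s₁ = quotient D∣s
      s≡s₁D : s ≡ s₁ * D
      s≡s₁D = m∣n⇒n≡quotient*m D∣s
      instance
        s₁≢0 : NonZero s₁
        s₁≢0 = quotient≢0 D∣s
      ∣s₁ : ∀ {x} → x * D ∣ s → x ∣ s₁
      ∣s₁ {x} xD∣s = *-cancelʳ-∣ D (subst (x * D ∣_) s≡s₁D xD∣s)
      k∣s₁ : k ∣ s₁
      k∣s₁ = coprime-divisor k⊥2 (*-cancelʳ-∣ p (subst (k * p ∣_) (trans s≡s₁D (lemma s₁ p)) kp∣s))
        where
        lemma : ∀ s p → s * (2 * p) ≡ 2 * s * p
        lemma = ℕ-Solver.solve-∀
      N∣s₁ : N ∣ s₁
      N∣s₁ = coprime-*-*-∣ h⊥h+1 h⊥k h+1⊥k (∣s₁ hD∣s) (∣s₁ h+1D∣s) k∣s₁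
      X = quotient N∣s₁
      instance
        X≢0 : NonZero X
        X≢0 = quotient≢0 N∣s₁
      s≡NXD : s ≡ N * X * D
      s≡NXD = trans s≡s₁D (cong (_* D) (m∣n⇒n≡m*quotient N∣s₁))
      PPVₚS∣ω : P * P * Vₚ * S ∣ ω D (N * X)
      PPVₚS∣ω = *-cancelˡ-∣ (P * Vₚ) {{m*n≢0 P Vₚ}} (subst₂ _∣_ K≡ (trans (cong u s≡NXD) (u-*D (N * X))) K∣uₛ)

    rank : Rank K T
    rank = record
      { T≢0 = m*n≢0 (N * (P * P * E)) D {{m*n≢0 N (P * P * E)}}
      ; K∣uT = subst₂ _∣_ (sym K≡) (sym (u-*D (N * (P * P * E)))) (*-monoʳ-∣ (P * Vₚ) (PPE∣⇒PPVₚS∣ω (P * P * E) ∣-refl))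
      ; least = K∣u⇒∣
      }

    rank-formula : 2 * (p * p) * g * T ≡ h * D * (k * p) * (suc h * D) * (P * P * Vₚ)
    rank-formula = trans (lemma h k p P E g) (cong (λ x → h * D * (k * p) * (suc h * D) * (P * P * x)) (sym Vₚ≡Eg))
      where
      lemma : ∀ h k p P E g → 2 * (p * p) * g * (h * (1 + h) * k * (P * P * E) * (2 * p))
                            ≡ h * (2 * p) * (k * p) * ((1 + h) * (2 * p)) * (P * P * (E * g))
      lemma = ℕ-Solver.solve-∀



open import Defs
open import Data.Nat.Base as ℕ using (ℕ; suc; NonZero)
import Data.Nat.Properties as ℕ
open import Data.Nat.Divisibility as ℕD using (_∣?_; quotient; quotient≢0; m∣n⇒n≡quotient*m; ∣m+n∣m⇒∣n; ∣-refl)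
open import Data.Nat.DivMod using (_/_; m*n/n≡m)
open import Data.Nat.Primality using (Prime; prime⇒nonZero; prime[2]; euclidsLemma)
open import Data.Nat.Coprimality as ℕC using ()
open import Data.Integer.Base as ℤ using (ℤ; +_; _*_; _>_)
open import Data.Integer.Properties using (pos-*; abs-*)
open import Data.Integer.GCD using (gcd)
import Data.Nat.GCD as ℕG
open import Data.Integer.Coprimality using (Coprime)
open import Data.Integer.Tactic.RingSolver using (solve-∀)
open import Data.Product.Base using (_×_; Σ; _,_)
open import Data.Sum.Base using (inj₁; inj₂)
open import Relation.Binary.PropositionalEquality
open import Relation.Nullary using (¬_; Dec; yes; no)
open import Relation.Nullary.Negation using (contradiction)
open import Function.Base using (case_of_)
import Data.Nat.Tactic.RingSolver as ℕ-Solver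
open Coprimality using (coprime-by-primes)

decide-cases : ∀ {A B : Set} {G F₁ F₂ F₃ F₄ : ℕ → Set} → Dec A → Dec B →
  (¬ A → ¬ B → Σ ℕ λ t → G t × F₁ t) → (¬ A → B → Σ ℕ λ t → G t × F₂ t) →
  (A → ¬ B → Σ ℕ λ t → G t × F₃ t) → (A → B → Σ ℕ λ t → G t × F₄ t) →
  Σ ℕ λ t → G t × ((¬ A → ¬ B → F₁ t) × (¬ A → B → F₂ t) × (A → ¬ B → F₃ t) × (A → B → F₄ t))
decide-cases (no ¬a) (no ¬b) c₁ _ _ _ with c₁ ¬a ¬b
... | t , g , f = t , g , (λ _ _ → f) , (λ _ b → contradiction b ¬b) ,
                          (λ a _ → contradiction a ¬a) , (λ a _ → contradiction a ¬a)
decide-cases (no ¬a) (yes b) _ c₂ _ _ with c₂ ¬a b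
... | t , g , f = t , g , (λ _ ¬b → contradiction b ¬b) , (λ _ _ → f) ,
                          (λ a _ → contradiction a ¬a) , (λ a _ → contradiction a ¬a)
decide-cases (yes a) (no ¬b) _ _ c₃ _ with c₃ a ¬b
... | t , g , f = t , g , (λ ¬a _ → contradiction a ¬a) , (λ ¬a _ → contradiction a ¬a) ,
                          (λ _ _ → f) , (λ _ b → contradiction b ¬b)
decide-cases (yes a) (yes b) _ _ _ c₄ with c₄ a b
... | t , g , f = t , g , (λ ¬a _ → contradiction a ¬a) , (λ ¬a _ → contradiction a ¬a) ,
                          (λ _ ¬b → contradiction b ¬b) , (λ _ _ → f)

module FourCases (a b : ℤ) (a⊥b : Coprime a b) (b≢0 : b ≢ + 0) (a>0 : a > + 0) (Δ>0 : a * a ℤ.+ + 4 * b > + 0)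
                (n p : ℕ) (n>0 : 0 ℕ.< n) (pp : Prime p) (p≥3 : 3 ℕ.≤ p) where

  open Arithmetic using (prime∣prime⇒≡; ≥3⇒≢2; +-nonZero)
  open LucasSequence a b a⊥b b≢0 a>0 Δ>0
  open RankOfProducts a b a⊥b b≢0 a>0 Δ>0

  IsOrder : ℕ → Set
  IsOrder = IsOrderOfAppearance a b (U a b n * U a b (n ℕ.+ p) * U a b (n ℕ.+ 2 ℕ.* p))

  rank⇒order : ∀ {x y z T} → x ≡ n → y ≡ n ℕ.+ p → z ≡ n ℕ.+ 2 ℕ.* p →
               Rank (u x ℕ.* u y ℕ.* u z) T → IsOrder T
  rank⇒order {T = T} refl refl refl R = ℕ.>-nonZero⁻¹ T {{T≢0}} , subst (ℕD._∣ u T) (sym ∣K∣≡) K∣uT ,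
    λ s s>0 K∣Uₛ → ℕD.∣⇒≤ {{ℕ.>-nonZero s>0}} (least s {{ℕ.>-nonZero s>0}} (subst (ℕD._∣ u s) ∣K∣≡ K∣Uₛ))
    where
    open Rank R
    ∣K∣≡ : ℤ.∣ U a b n * U a b (n ℕ.+ p) * U a b (n ℕ.+ 2 ℕ.* p) ∣ ≡ u n ℕ.* u (n ℕ.+ p) ℕ.* u (n ℕ.+ 2 ℕ.* p)
    ∣K∣≡ = trans (abs-* (U a b n * U a b (n ℕ.+ p)) _) (cong (ℕ._* u (n ℕ.+ 2 ℕ.* p)) (abs-* (U a b n) _))

  instance
    n≢0 : NonZero n
    n≢0 = ℕ.>-nonZero n>0
    p≢0 : NonZero p
    p≢0 = prime⇒nonZero pp
    N₂≢0 : NonZero (n ℕ.+ p)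
    N₂≢0 = +-nonZero n p
    N₃≢0 : NonZero (n ℕ.+ 2 ℕ.* p)
    N₃≢0 = +-nonZero n (2 ℕ.* p)

  N₃≡N₂+p : n ℕ.+ 2 ℕ.* p ≡ n ℕ.+ p ℕ.+ p
  N₃≡N₂+p = lemma n p
    where
    lemma : ∀ n p → n ℕ.+ 2 ℕ.* p ≡ n ℕ.+ p ℕ.+ p
    lemma = ℕ-Solver.solve-∀

  common⇒≡p : ∀ {q x} → Prime q → q ℕD.∣ x → q ℕD.∣ x ℕ.+ p → q ≡ p
  common⇒≡p pq q∣x q∣x+p = prime∣prime⇒≡ pq pp (∣m+n∣m⇒∣n q∣x+p q∣x)

  pos-*-* : ∀ x y z → + x * + y * + z ≡ + (x ℕ.* y ℕ.* z)
  pos-*-* x y z = trans (cong (_* + z) (sym (pos-* x y))) (sym (pos-* (x ℕ.* y) z))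

  N : ℕ
  N = n ℕ.* (n ℕ.+ p) ℕ.* (n ℕ.+ 2 ℕ.* p)

  reindex : ∀ {x y z} (F : ℕ → ℕ → ℕ → Set) → x ≡ n → y ≡ n ℕ.+ p → z ≡ n ℕ.+ 2 ℕ.* p →
            F x y z → F n (n ℕ.+ p) (n ℕ.+ 2 ℕ.* p)
  reindex F refl refl refl Fxyz = Fxyz

  a≡A : a ≡ + u 2
  a≡A = trans (sym (lemma a b)) (U≡u 2)
    where
    lemma : ∀ a b → a * + 1 ℤ.+ b * + 0 ≡ a
    lemma = solve-∀

  coprime-case : ¬ p ℕD.∣ n → ¬ 2 ℕD.∣ n → Σ ℕ λ t → IsOrder t × t ≡ n ℕ.* (n ℕ.+ p) ℕ.* (n ℕ.+ 2 ℕ.* p)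
  coprime-case p∤n 2∤n =
    _ , rank⇒order refl refl refl (rank-coprime n≢2 (≥3⇒≢2 N₂≥3) (≥3⇒≢2 N₃≥3) n⊥N₂ n⊥N₃ N₂⊥N₃) , refl
    where
    n≢2 : n ≢ 2
    n≢2 n≡2 = 2∤n (subst (2 ℕD.∣_) (sym n≡2) ∣-refl)
    N₂≥3 : 3 ℕ.≤ n ℕ.+ p
    N₂≥3 = ℕ.≤-trans p≥3 (ℕ.m≤n+m p n)
    N₃≥3 : 3 ℕ.≤ n ℕ.+ 2 ℕ.* p
    N₃≥3 = ℕ.≤-trans p≥3 (ℕ.≤-trans (ℕ.m≤n*m p 2) (ℕ.m≤n+m (2 ℕ.* p) n))
    n⊥N₂ : ℕC.Coprime n (n ℕ.+ p)
    n⊥N₂ = coprime-by-primes λ q pq q∣n q∣N₂ → p∤n (subst (ℕD._∣ n) (common⇒≡p pq q∣n q∣N₂) q∣n)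
    N₂⊥N₃ : ℕC.Coprime (n ℕ.+ p) (n ℕ.+ 2 ℕ.* p)
    N₂⊥N₃ = coprime-by-primes λ q pq q∣N₂ q∣N₃ →
      let p∣N₂ = subst (ℕD._∣ n ℕ.+ p) (common⇒≡p pq q∣N₂ (subst (q ℕD.∣_) N₃≡N₂+p q∣N₃)) q∣N₂
      in p∤n (∣m+n∣m⇒∣n (subst (p ℕD.∣_) (ℕ.+-comm n p) p∣N₂) ∣-refl)
    n⊥N₃ : ℕC.Coprime n (n ℕ.+ 2 ℕ.* p)
    n⊥N₃ = coprime-by-primes λ q pq q∣n q∣N₃ → case euclidsLemma 2 p pq (∣m+n∣m⇒∣n q∣N₃ q∣n) of λ where
      (inj₁ q∣2) → 2∤n (subst (ℕD._∣ n) (prime∣prime⇒≡ pq prime[2] q∣2) q∣n)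
      (inj₂ q∣p) → p∤n (subst (ℕD._∣ n) (prime∣prime⇒≡ pq pp q∣p) q∣n)


  even-coprime-case : ¬ p ℕD.∣ n → 2 ℕD.∣ n →
    Σ ℕ λ t → IsOrder t × (+ 2 * gcd a (+ (n ℕ.+ p)) * + t ≡ + N * a)
  even-coprime-case p∤n 2∣n = t , rank⇒order n₁2≡ N₂≡ N₃≡ E.rank , formula
    where
    n₁ = quotient 2∣n
    n₁2≡ : n₁ ℕ.* 2 ≡ n
    n₁2≡ = sym (m∣n⇒n≡quotient*m 2∣n)
    instance
      n₁≢0 : NonZero n₁
      n₁≢0 = quotient≢0 2∣n
    module E = EvenCoprime n₁ p pp p≥3 (λ p∣n₁ → p∤n (subst (p ℕD.∣_) n₁2≡ (ℕD.∣m⇒∣m*n 2 p∣n₁)))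
    t = n₁ ℕ.* E.n₂ ℕ.* E.L ℕ.* 2
    N₂≡ : E.N₂ ≡ n ℕ.+ p
    N₂≡ = cong (ℕ._+ p) n₁2≡
    N₃≡ : E.n₂ ℕ.* 2 ≡ n ℕ.+ 2 ℕ.* p
    N₃≡ = trans (lemma n₁ p) (cong (ℕ._+ 2 ℕ.* p) n₁2≡)
      where
      lemma : ∀ n p → (n ℕ.+ p) ℕ.* 2 ≡ n ℕ.* 2 ℕ.+ 2 ℕ.* p
      lemma = ℕ-Solver.solve-∀
    formulaℕ : 2 ℕ.* ℕG.gcd (u 2) (n ℕ.+ p) ℕ.* t ≡ N ℕ.* u 2
    formulaℕ = reindex (λ x y z → 2 ℕ.* ℕG.gcd (u 2) y ℕ.* t ≡ x ℕ.* y ℕ.* z ℕ.* u 2) n₁2≡ N₂≡ N₃≡ E.rank-formula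
    formula : + 2 * gcd a (+ (n ℕ.+ p)) * + t ≡ + N * a
    formula = begin
      + 2 * + ℕG.gcd ℤ.∣ a ∣ (n ℕ.+ p) * + t  ≡⟨ cong (λ x → + 2 * + ℕG.gcd ℤ.∣ x ∣ (n ℕ.+ p) * + t) a≡A ⟩
      + 2 * + ℕG.gcd (u 2) (n ℕ.+ p) * + t    ≡⟨ pos-*-* 2 (ℕG.gcd (u 2) (n ℕ.+ p)) t ⟩
      + (2 ℕ.* ℕG.gcd (u 2) (n ℕ.+ p) ℕ.* t)  ≡⟨ cong +_ formulaℕ ⟩
      + (N ℕ.* u 2)                           ≡⟨ pos-* N (u 2) ⟩
      + N * + u 2                             ≡⟨ cong (+ N *_) a≡A ⟨
      + N * a                                 ∎
      where open ≡-Reasoning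

  odd-multiple-case : p ℕD.∣ n → ¬ 2 ℕD.∣ n →
    Σ ℕ λ t → IsOrder t × (+ (p ℕ.* p) * + t ≡ + N * (U a b p * U a b p))
  odd-multiple-case p∣n 2∤n = t , rank⇒order mp≡ N₂≡ N₃≡ O.rank , formula
    where
    m = quotient p∣n
    mp≡ : m ℕ.* p ≡ n
    mp≡ = sym (m∣n⇒n≡quotient*m p∣n)
    instance
      m≢0 : NonZero m
      m≢0 = quotient≢0 p∣n
    module O = OddMultiple m p pp p≥3 (λ 2∣m → 2∤n (subst (2 ℕD.∣_) mp≡ (ℕD.∣m⇒∣m*n p 2∣m)))
    t = O.M ℕ.* (O.P ℕ.* O.P) ℕ.* p
    N₂≡ : suc m ℕ.* p ≡ n ℕ.+ p
    N₂≡ = trans (ℕ.+-comm p (m ℕ.* p)) (cong (ℕ._+ p) mp≡)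
    N₃≡ : suc (suc m) ℕ.* p ≡ n ℕ.+ 2 ℕ.* p
    N₃≡ = trans (lemma m p) (cong (ℕ._+ 2 ℕ.* p) mp≡)
      where
      lemma : ∀ m p → (2 ℕ.+ m) ℕ.* p ≡ m ℕ.* p ℕ.+ 2 ℕ.* p
      lemma = ℕ-Solver.solve-∀
    formulaℕ : p ℕ.* p ℕ.* t ≡ N ℕ.* (u p ℕ.* u p)
    formulaℕ = reindex (λ x y z → p ℕ.* p ℕ.* t ≡ x ℕ.* y ℕ.* z ℕ.* (u p ℕ.* u p)) mp≡ N₂≡ N₃≡ O.rank-formula
    formula : + (p ℕ.* p) * + t ≡ + N * (U a b p * U a b p)
    formula = begin
      + (p ℕ.* p) * + t          ≡⟨ pos-* (p ℕ.* p) t ⟨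
      + (p ℕ.* p ℕ.* t)          ≡⟨ cong +_ formulaℕ ⟩
      + (N ℕ.* (u p ℕ.* u p))    ≡⟨ trans (pos-* N _) (cong (+ N *_) (pos-* (u p) (u p))) ⟩
      + N * (+ u p * + u p)      ≡⟨ cong (λ x → + N * (x * x)) (U≡u p) ⟨
      + N * (U a b p * U a b p)  ∎
      where open ≡-Reasoning

  even-multiple-case : p ℕD.∣ n → 2 ℕD.∣ n →
    Σ ℕ λ t → IsOrder t × (+ (2 ℕ.* (p ℕ.* p)) * gcd (V a b p) (+ ((n ℕ.+ p) / p)) * + t
                           ≡ + N * (U a b p * U a b p * V a b p))
  even-multiple-case p∣n 2∣n = t , rank⇒order hD≡ N₂≡ N₃≡ E.rank , formula
    where
    m = quotient p∣n
    mp≡ : m ℕ.* p ≡ n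
    mp≡ = sym (m∣n⇒n≡quotient*m p∣n)
    2∣m : 2 ℕD.∣ m
    2∣m with euclidsLemma m p prime[2] (subst (2 ℕD.∣_) (sym mp≡) 2∣n)
    ... | inj₁ 2∣m = 2∣m
    ... | inj₂ 2∣p = contradiction (sym (prime∣prime⇒≡ prime[2] pp 2∣p)) (≥3⇒≢2 p≥3)
    h = quotient 2∣m
    instance
      h≢0 : NonZero h
      h≢0 = quotient≢0 2∣m {{quotient≢0 p∣n}}
    module E = EvenMultiple h p pp p≥3
    t = E.T
    hD≡ : h ℕ.* E.D ≡ n
    hD≡ = trans (sym (ℕ.*-assoc h 2 p)) (trans (cong (ℕ._* p) (sym (m∣n⇒n≡quotient*m 2∣m))) mp≡)
    N₂≡ : E.k ℕ.* p ≡ n ℕ.+ p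
    N₂≡ = trans (lemma h p) (cong (ℕ._+ p) hD≡)
      where
      lemma : ∀ h p → (1 ℕ.+ 2 ℕ.* h) ℕ.* p ≡ h ℕ.* (2 ℕ.* p) ℕ.+ p
      lemma = ℕ-Solver.solve-∀
    N₃≡ : suc h ℕ.* E.D ≡ n ℕ.+ 2 ℕ.* p
    N₃≡ = trans (ℕ.+-comm E.D (h ℕ.* E.D)) (cong (ℕ._+ 2 ℕ.* p) hD≡)
    [n+p]/p≡k : (n ℕ.+ p) / p ≡ E.k
    [n+p]/p≡k = trans (cong (_/ p) (sym N₂≡)) (m*n/n≡m E.k p)
    formulaℕ : 2 ℕ.* (p ℕ.* p) ℕ.* ℕG.gcd (v p) E.k ℕ.* t ≡ N ℕ.* (u p ℕ.* u p ℕ.* v p)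
    formulaℕ = reindex (λ x y z → 2 ℕ.* (p ℕ.* p) ℕ.* E.g ℕ.* t ≡ x ℕ.* y ℕ.* z ℕ.* (u p ℕ.* u p ℕ.* v p))
                       hD≡ N₂≡ N₃≡ E.rank-formula
    formula : + (2 ℕ.* (p ℕ.* p)) * gcd (V a b p) (+ ((n ℕ.+ p) / p)) * + t ≡ + N * (U a b p * U a b p * V a b p)
    formula = begin
      + (2 ℕ.* (p ℕ.* p)) * + ℕG.gcd (v p) ((n ℕ.+ p) / p) * + t
        ≡⟨ cong (λ x → + (2 ℕ.* (p ℕ.* p)) * + ℕG.gcd (v p) x * + t) [n+p]/p≡k ⟩
      + (2 ℕ.* (p ℕ.* p)) * + ℕG.gcd (v p) E.k * + t              ≡⟨ pos-*-* (2 ℕ.* (p ℕ.* p)) (ℕG.gcd (v p) E.k) t ⟩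
      + (2 ℕ.* (p ℕ.* p) ℕ.* ℕG.gcd (v p) E.k ℕ.* t)              ≡⟨ cong +_ formulaℕ ⟩
      + (N ℕ.* (u p ℕ.* u p ℕ.* v p))
        ≡⟨ trans (pos-* N _) (cong (+ N *_) (sym (pos-*-* (u p) (u p) (v p)))) ⟩
      + N * (+ u p * + u p * + v p)                                ≡⟨ cong₂ (λ x y → + N * (x * x * y)) (U≡u p) (V≡v p) ⟨
      + N * (U a b p * U a b p * V a b p)                          ∎
      where open ≡-Reasoning

theorem1p2 : (a b : ℤ) → Coprime a b → NonDegenerate a b → a > + 0 → a * a ℤ.+ + 4 * b > + 0 →
  (n p : ℕ) → 0 ℕ.< n → (pp : Prime p) → 3 ℕ.≤ p →
  Σ ℕ (λ t → IsOrderOfAppearance a b (U a b n * U a b (n ℕ.+ p) * U a b (n ℕ.+ 2 ℕ.* p)) t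
    × ((¬ (p ℕD.∣ n) → ¬ (2 ℕD.∣ n) →
          t ≡ n ℕ.* (n ℕ.+ p) ℕ.* (n ℕ.+ 2 ℕ.* p))
     × (¬ (p ℕD.∣ n) → 2 ℕD.∣ n →
          + 2 * gcd a (+ (n ℕ.+ p)) * + t
            ≡ + (n ℕ.* (n ℕ.+ p) ℕ.* (n ℕ.+ 2 ℕ.* p)) * a)
     × (p ℕD.∣ n → ¬ (2 ℕD.∣ n) →
          + (p ℕ.* p) * + t
            ≡ + (n ℕ.* (n ℕ.+ p) ℕ.* (n ℕ.+ 2 ℕ.* p)) * (U a b p * U a b p))
     × (p ℕD.∣ n → 2 ℕD.∣ n →
          + (2 ℕ.* (p ℕ.* p)) * gcd (V a b p) (+ (_/_ (n ℕ.+ p) p {{prime⇒nonZero pp}})) * + t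
            ≡ + (n ℕ.* (n ℕ.+ p) ℕ.* (n ℕ.+ 2 ℕ.* p)) * (U a b p * U a b p * V a b p))))
theorem1p2 a b a⊥b (b≢0 , _) a>0 Δ>0 n p n>0 pp p≥3 =
  decide-cases (p ∣? n) (2 ∣? n) coprime-case even-coprime-case odd-multiple-case even-multiple-case
  where open FourCases a b a⊥b b≢0 a>0 Δ>0 n p n>0 pp p≥3
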